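{- Let $G=(V\cup\{s\},E)$ be a finite, connected, undirected, loop-free graph (multiple edges allowed) with sink $s\notin V$, $p\in(0,1)$, and let $e=\{a,b\}\in E$ be an edge which is not a bridge and not incident to $s$, of multiplicity $k\ge1$. With $f$ defined on ${\sf Sto}(G)$ by: $f(\eta)=\eta-\mathbbm{1}_a$ (a configuration on $G\setminus e$) if $\eta\in{\sf Sto}_{(A)}(G)$, and, if $\eta\in{\sf Sto}_{(B)}(G)$, $f(\eta)$ the configuration on $G.e$ with $f(\eta)_v=\eta_v$ for $v\neq a.b$ and $l^{G.e}_{f(\eta)}(a.b)=l^G_\eta(a)+l^G_\eta(b)$, we have $$f({\sf Sto}(G))\subseteq{\sf Sto}(G\setminus e)\cup{\sf Sto}(G.e).$$
   Context: $\mathbbm{1}_a$ is the indicator vector of $a$. $G\setminus e$ is $G$ with one copy of $e$ removed. $G.e$: if $k=1$, contract $e$, merging $a,b$ into a vertex $a.b$ carrying all other edges of $a$ and $b$; if $k\ge2$, contract one copy and replace the other $k-1$ copies by $k-1$ edges $\{a.b,s\}$. For such a graph $H=(W\cup\{s\},F)$: $d^H(v)$ is degree with multiplicity; configurations $\eta\in\mathbb{Z}_{\ge0}^W$ are stable if $\eta_v\le d^H(v)$; $l^H_\eta(v)=d^H(v)-\eta_v$. In the stochastic sandpile model with parameter $p$, a legal stochastic toppling at $x\in W$ (allowed when $\eta_x>d^H(x)$) chooses independently for each edge at $x$ a Bernoulli($p$) variable, removes the number of successes from $x$ and sends one grain along each successful edge to its other endpoint (discarded at $s$). The Markov chain on stable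 configurations adds a grain at a random vertex of $W$ (distribution with support $W$) then topples until stable; ${\sf Sto}(H)$ is its recurrent class containing $\eta^{\max}=(d^H(v))_{v\in W}$. An orientation orients every edge (parallel edges independently); ${\sf in}_O(v)$ is the in-degree; $\eta$ is compatible with $O$ if ${\sf in}_O(v)\ge1+l_\eta(v)$ for all non-sink $v$. ${\sf Sto}_{(A)}(G)$ is the set of $\eta\in{\sf Sto}(G)$ with $l^G_\eta(b)>0$ for which some orientation compatible with $\eta$ orients some edge between $a$ and $b$ as $a\to b$; ${\sf Sto}_{(B)}(G)={\sf Sto}(G)\setminus{\sf Sto}_{(A)}(G)$. -}

module Defs where

open import Data.Nat using (ℕ; zero; suc; _+_; _∸_; _≤_; _<_)
open import Data.Fin using (Fin; punchOut) renaming (zero to fzero; suc to fsuc)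
import Data.Fin as F
open import Data.Maybe using (Maybe; just; nothing)
open import Data.Maybe.Properties using (≡-dec)
open import Data.Bool using (Bool; true; false; if_then_else_; _∧_; _∨_)
open import Data.Product using (Σ; _×_; _,_; ∃)
open import Relation.Nullary using (¬_; yes; no)
open import Relation.Nullary.Decidable using (⌊_⌋)
open import Relation.Binary.PropositionalEquality using (_≡_; _≢_; refl; sym)
open import Relation.Binary.Construct.Closure.ReflexiveTransitive using (Star)

Vtx : ℕ → Set
Vtx n = Maybe (Fin n)

sink : ∀ {n} → Vtx n
sink = nothing

_≟V_ : ∀ {n} (u w : Vtx n) → Relation.Nullary.Dec (u ≡ w)
_≟V_ = ≡-dec F._≟_

Mult : ℕ → Set
Mult n = Vtx n → Vtx n → ℕ

Symmetric : ∀ {n} → Mult n → Set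
Symmetric M = ∀ x y → M x y ≡ M y x

LoopFree : ∀ {n} → Mult n → Set
LoopFree M = ∀ x → M x x ≡ 0

data Reach {n} (M : Mult n) (x : Vtx n) : Vtx n → Set where
  here : Reach M x x
  step : ∀ {y z} → Reach M x y → 0 < M y z → Reach M x z

Connected : ∀ {n} → Mult n → Set
Connected M = ∀ v → Reach M sink v

sumFin : ∀ {n} → (Fin n → ℕ) → ℕ
sumFin {zero}  f = 0
sumFin {suc n} f = f fzero + sumFin (λ i → f (fsuc i))

sumV : ∀ {n} → (Vtx n → ℕ) → ℕ
sumV f = f nothing + sumFin (λ i → f (just i))

deg : ∀ {n} → Mult n → Vtx n → ℕ
deg M v = sumV (M v)

Config : ℕ → Set
Config n = Fin n → ℕ

Stable : ∀ {n} → Mult n → Config n → Set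
Stable M η = ∀ v → η v ≤ deg M (just v)

ηmax : ∀ {n} → Mult n → Config n
ηmax M v = deg M (just v)

-- l_η(v) = d(v) - η_v   (used only for stable η)
lvl : ∀ {n} → Mult n → Config n → Fin n → ℕ
lvl M η v = deg M (just v) ∸ η v

addGrain : ∀ {n} → Fin n → Config n → Config n
addGrain x η w = if ⌊ w F.≟ x ⌋ then suc (η w) else η w

-- A legal stochastic toppling at x with a positive-probability outcome:
-- c y = number of successful copies of the edges {x,y}
-- (0 ≤ c y ≤ M x y); c(x) ≤ M x x = 0 for loop-free graphs.
-- x loses sumV c grains, every non-sink y gains c y (grains to s are lost).
data TopStep {n} (M : Mult n) (η η' : Config n) : Set where
  topple : (x : Fin n) → deg M (just x) < η x →
           (c : Vtx n → ℕ) → (∀ y → c y ≤ M (just x) y) →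
           (∀ v → η' v + (if ⌊ v F.≟ x ⌋ then sumV c else 0) ≡ η v + c (just v)) →
           TopStep M η η'

-- One step of the Markov chain with positive probability:
-- add a grain at some x ∈ W, then topple until stable.
Trans : ∀ {n} → Mult n → Config n → Config n → Set
Trans M η η' = Σ _ λ x → Star (TopStep M) (addGrain x η) η' × Stable M η'

-- Sto(H): recurrent class containing ηmax = states reachable from ηmax.
Sto : ∀ {n} → Mult n → Config n → Set
Sto M η = Star (Trans M) (ηmax M) η

-- Orientations: o x y = number of copies of {x,y} oriented x → y.

record Orientation {n} (M : Mult n) : Set where
  field
    o     : Vtx n → Vtx n → ℕ
    split : ∀ x y → o x y + o y x ≡ M x y

indeg : ∀ {n} {M : Mult n} → Orientation M → Vtx n → ℕ
indeg O v = sumV (λ x → Orientation.o O x v)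

Compatible : ∀ {n} (M : Mult n) → Config n → Orientation M → Set
Compatible M η O = ∀ v → suc (lvl M η v) ≤ indeg O (just v)

StoA : ∀ {n} (M : Mult n) (a b : Fin n) → Config n → Set
StoA M a b η = Sto M η × 0 < lvl M η b ×
  Σ (Orientation M) λ O → Compatible M η O × 1 ≤ Orientation.o O (just a) (just b)

isPair : ∀ {n} → Vtx n → Vtx n → Vtx n → Vtx n → Bool
isPair a b u w = (⌊ u ≟V a ⌋ ∧ ⌊ w ≟V b ⌋) ∨ (⌊ u ≟V b ⌋ ∧ ⌊ w ≟V a ⌋)

delete : ∀ {n} → Mult n → Fin n → Fin n → Mult n
delete M a b u w = M u w ∸ (if isPair (just a) (just b) u w then 1 else 0)

-- Contraction G.e, for a ≢ b in Fin (suc m).  New vertex set Fin m: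
-- b is punched out, a ↦ a.b.

module Contraction {m : ℕ} (M : Mult (suc m)) (a b : Fin (suc m)) (a≢b : a ≢ b) where

  b≢a : b ≢ a
  b≢a e = a≢b (sym e)

  ab : Fin m
  ab = punchOut b≢a

  π : Vtx (suc m) → Vtx m
  π nothing = nothing
  π (just v) with v F.≟ b
  ... | yes _ = just ab
  ... | no v≢b = just (punchOut {i = b} {j = v} (λ e → v≢b (sym e)))

  -- new multiplicities: all edges between the preimages; the a–b edges
  -- disappear as loops, and k-1 = M a b ∸ 1 extra edges {a.b, s} are added.
  contractM : Mult m
  contractM u w =
    if ⌊ u ≟V w ⌋ then 0 else
      (sumV (λ x → sumV (λ y →
         if ⌊ π x ≟V u ⌋ ∧ ⌊ π y ≟V w ⌋ then M x y else 0))
       + (if isPair (just ab) sink u w then M (just a) (just b) ∸ 1 else 0))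

-- The proof rests on the orientation characterisation of the recurrent class: for a connected
-- loop-free multigraph H, Sto(H) consists exactly of the stable configurations that admit a
-- compatible orientation.  Every configuration reached from η^max has one, because η^max does
-- (orient a spanning tree away from the sink) and a toppling at x that sends c_y grains to y is
-- absorbed by reversing min(o(x → y), c_y) of the edges x → y.  Conversely, a stable configuration
-- with a compatible orientation is recurrent, by induction on the number of vertices: merge a
-- neighbour u of the sink into the sink, run the smaller chain while u stays saturated, and finish
-- with one toppling of u along its in-edges.  The lemma then only asks to transport orientations:
-- in case (A) drop one edge oriented a → b, in case (B) contract e and orient the k − 1 new edges
-- {a.b, s} towards a.b.
module Submission where

open import Defs
open import Data.Bool using (Bool; true; false; if_then_else_; _∧_; _∨_)
open import Data.Bool.Properties using (∧-comm; ∨-comm; ∧-zeroʳ; ∨-identityʳ; ∧-identityʳ)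
open import Data.Empty using (⊥-elim)
open import Function using (_∘_)
open import Data.Fin using (Fin; punchOut; punchIn) renaming (zero to fzero; suc to fsuc)
import Data.Fin as F
import Data.Fin.Properties as FP
open import Data.Maybe using (just; nothing)
import Data.Maybe.Properties as MP
open import Data.Nat using (ℕ; zero; suc; _+_; _∸_; _⊓_; _≤_; _<_; z≤n; s≤s)
open import Data.Nat.Properties
open import Algebra.Properties.CommutativeSemigroup +-commutativeSemigroup using (interchange)
open import Data.Product using (Σ; _×_; _,_; proj₁; proj₂)
open import Data.Rational using (ℚ; 0ℚ; 1ℚ) renaming (_<_ to _<ℚ_)
open import Data.Sum using (_⊎_; inj₁; inj₂)
open import Relation.Binary.Construct.Closure.ReflexiveTransitive using (Star; ε; _◅_; _◅◅_)
open import Relation.Binary.PropositionalEquality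
open import Relation.Nullary using (¬_; yes; no; Dec; _because_)
open import Relation.Nullary.Decidable using (⌊_⌋; ⌊⌋-map′)
open import Relation.Nullary.Negation using (contradiction)
open import Relation.Nullary.Reflects using (invert)

⌊⌋-true : ∀ {a} {A : Set a} (d : Dec A) → A → ⌊ d ⌋ ≡ true
⌊⌋-true (true because _) _ = refl
⌊⌋-true (false because [¬a]) a = contradiction a (invert [¬a])

⌊⌋-false : ∀ {a} {A : Set a} (d : Dec A) → ¬ A → ⌊ d ⌋ ≡ false
⌊⌋-false (false because _) _ = refl
⌊⌋-false (true because [a]) ¬a = contradiction (invert [a]) ¬a

⌊⌋-sym : ∀ {a} {A : Set a} {x y : A} (d : Dec (x ≡ y)) (d′ : Dec (y ≡ x)) → ⌊ d ⌋ ≡ ⌊ d′ ⌋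
⌊⌋-sym (yes x≡y) d′ = sym (⌊⌋-true d′ (sym x≡y))
⌊⌋-sym (no x≢y) d′ = sym (⌊⌋-false d′ (λ y≡x → x≢y (sym y≡x)))

⌊just≟just⌋ : ∀ {n} (i j : Fin n) → ⌊ just i ≟V just j ⌋ ≡ ⌊ i F.≟ j ⌋
⌊just≟just⌋ i j = ⌊⌋-map′ (cong just) MP.just-injective (i F.≟ j)

m∸n+m⊓n≡m : ∀ m n → (m ∸ n) + (m ⊓ n) ≡ m
m∸n+m⊓n≡m m n = trans (+-comm (m ∸ n) _) (trans (cong (_+ (m ∸ n)) (⊓-comm m n)) (m⊓n+n∸m≡n n m))

sumFin-cong : ∀ {n} {f g : Fin n → ℕ} → f ≗ g → sumFin f ≡ sumFin g
sumFin-cong {zero} e = refl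
sumFin-cong {suc n} e = cong₂ _+_ (e fzero) (sumFin-cong (λ i → e (fsuc i)))

sumV-cong : ∀ {n} {f g : Vtx n → ℕ} → f ≗ g → sumV f ≡ sumV g
sumV-cong e = cong₂ _+_ (e nothing) (sumFin-cong (λ i → e (just i)))

sumFin-+ : ∀ {n} (f g : Fin n → ℕ) → sumFin (λ i → f i + g i) ≡ sumFin f + sumFin g
sumFin-+ {zero} f g = refl
sumFin-+ {suc n} f g =
  trans (cong (f fzero + g fzero +_) (sumFin-+ (λ i → f (fsuc i)) (λ i → g (fsuc i))))
        (interchange (f fzero) (g fzero) _ _)

sumV-+ : ∀ {n} (f g : Vtx n → ℕ) → sumV (λ i → f i + g i) ≡ sumV f + sumV g
sumV-+ f g = trans (cong (f nothing + g nothing +_) (sumFin-+ (λ i → f (just i)) (λ i → g (just i))))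
                   (interchange (f nothing) (g nothing) _ _)

sumFin-zero : ∀ {n} (f : Fin n → ℕ) → (∀ i → f i ≡ 0) → sumFin f ≡ 0
sumFin-zero {zero} f e = refl
sumFin-zero {suc n} f e = cong₂ _+_ (e fzero) (sumFin-zero (λ i → f (fsuc i)) (λ i → e (fsuc i)))

sumV-zero : ∀ {n} (f : Vtx n → ℕ) → (∀ i → f i ≡ 0) → sumV f ≡ 0
sumV-zero f e = cong₂ _+_ (e nothing) (sumFin-zero (λ i → f (just i)) (λ i → e (just i)))

sumFin-mono : ∀ {n} {f g : Fin n → ℕ} → (∀ i → f i ≤ g i) → sumFin f ≤ sumFin g
sumFin-mono {zero} e = z≤n
sumFin-mono {suc n} e = +-mono-≤ (e fzero) (sumFin-mono (λ i → e (fsuc i)))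

sumV-mono : ∀ {n} {f g : Vtx n → ℕ} → (∀ i → f i ≤ g i) → sumV f ≤ sumV g
sumV-mono e = +-mono-≤ (e nothing) (sumFin-mono (λ i → e (just i)))

sumFin-comm : ∀ {n k} (f : Fin n → Fin k → ℕ) →
  sumFin (λ i → sumFin (f i)) ≡ sumFin (λ j → sumFin (λ i → f i j))
sumFin-comm {zero} {k} f = sym (sumFin-zero {k} _ (λ _ → refl))
sumFin-comm {suc n} f =
  trans (cong (sumFin (f fzero) +_) (sumFin-comm (λ i → f (fsuc i)))) (sym (sumFin-+ (f fzero) _))

sumV-comm : ∀ {n k} (f : Vtx n → Vtx k → ℕ) →
  sumV (λ i → sumV (f i)) ≡ sumV (λ j → sumV (λ i → f i j))
sumV-comm f = begin
  sumV (f nothing) + sumFin (λ i → f (just i) nothing + sumFin (λ j → f (just i) (just j)))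
    ≡⟨ cong (sumV (f nothing) +_) (sumFin-+ (λ i → f (just i) nothing) _) ⟩
  sumV (f nothing) + (sumFin (λ i → f (just i) nothing) + sumFin (λ i → sumFin (λ j → f (just i) (just j))))
    ≡⟨ cong (λ z → sumV (f nothing) + (sumFin (λ i → f (just i) nothing) + z))
            (sumFin-comm (λ i j → f (just i) (just j))) ⟩
  sumV (f nothing) + (sumFin (λ i → f (just i) nothing) + sumFin (λ j → sumFin (λ i → f (just i) (just j))))
    ≡⟨ interchange (f nothing nothing) _ _ _ ⟩
  sumV (λ i → f i nothing) + (sumFin (λ j → f nothing (just j)) + sumFin (λ j → sumFin (λ i → f (just i) (just j))))
    ≡⟨ cong (sumV (λ i → f i nothing) +_) (sumFin-+ (λ j → f nothing (just j)) _) ⟨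
  sumV (λ i → f i nothing) + sumFin (λ j → sumV (λ i → f i (just j))) ∎
  where open ≡-Reasoning

sumFin-punchIn : ∀ {m} (i : Fin (suc m)) (f : Fin (suc m) → ℕ) →
  sumFin f ≡ f i + sumFin (λ j → f (punchIn i j))
sumFin-punchIn fzero f = refl
sumFin-punchIn {suc m} (fsuc i) f = begin
  f fzero + sumFin (λ j → f (fsuc j))
    ≡⟨ cong (f fzero +_) (sumFin-punchIn i (λ j → f (fsuc j))) ⟩
  f fzero + (f (fsuc i) + sumFin (λ j → f (fsuc (punchIn i j))))
    ≡⟨ +-assoc (f fzero) _ _ ⟨
  f fzero + f (fsuc i) + sumFin (λ j → f (fsuc (punchIn i j)))
    ≡⟨ cong (_+ sumFin (λ j → f (fsuc (punchIn i j)))) (+-comm (f fzero) _) ⟩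
  f (fsuc i) + f fzero + sumFin (λ j → f (fsuc (punchIn i j)))
    ≡⟨ +-assoc (f (fsuc i)) _ _ ⟩
  f (fsuc i) + (f fzero + sumFin (λ j → f (fsuc (punchIn i j)))) ∎
  where open ≡-Reasoning

sumV-punchIn : ∀ {m} (i : Fin (suc m)) (f : Vtx (suc m) → ℕ) →
  sumV f ≡ f (just i) + (f nothing + sumFin (λ j → f (just (punchIn i j))))
sumV-punchIn i f = begin
  f nothing + sumFin (λ j → f (just j))
    ≡⟨ cong (f nothing +_) (sumFin-punchIn i (λ j → f (just j))) ⟩
  f nothing + (f (just i) + R)  ≡⟨ +-assoc (f nothing) _ _ ⟨
  f nothing + f (just i) + R    ≡⟨ cong (_+ R) (+-comm (f nothing) _) ⟩
  f (just i) + f nothing + R    ≡⟨ +-assoc (f (just i)) _ _ ⟩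
  f (just i) + (f nothing + R)  ∎
  where
  open ≡-Reasoning
  R = sumFin (λ j → f (just (punchIn i j)))

term≤sumFin : ∀ {n} (f : Fin n → ℕ) i → f i ≤ sumFin f
term≤sumFin f fzero = m≤m+n _ _
term≤sumFin f (fsuc i) = ≤-trans (term≤sumFin (λ j → f (fsuc j)) i) (m≤n+m _ (f fzero))

term≤sumV : ∀ {n} (f : Vtx n → ℕ) v → f v ≤ sumV f
term≤sumV f nothing = m≤m+n _ _
term≤sumV f (just i) = ≤-trans (term≤sumFin (λ j → f (just j)) i) (m≤n+m _ (f nothing))

sumFin-indicator : ∀ {n} (i : Fin n) (h : Fin n → ℕ) →
  sumFin (λ j → if ⌊ i F.≟ j ⌋ then h j else 0) ≡ h i
sumFin-indicator {suc m} i h = begin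
  sumFin (λ j → if ⌊ i F.≟ j ⌋ then h j else 0)
    ≡⟨ sumFin-punchIn i (λ j → if ⌊ i F.≟ j ⌋ then h j else 0) ⟩
  (if ⌊ i F.≟ i ⌋ then h i else 0) + sumFin (λ j → if ⌊ i F.≟ punchIn i j ⌋ then h (punchIn i j) else 0)
    ≡⟨ cong₂ _+_ (cong (λ b → if b then h i else 0) (⌊⌋-true (i F.≟ i) refl))
         (sumFin-zero _ (λ j → cong (λ b → if b then h (punchIn i j) else 0)
                                    (⌊⌋-false (i F.≟ punchIn i j) (λ e → FP.punchInᵢ≢i i j (sym e))))) ⟩
  h i + 0 ≡⟨ +-identityʳ _ ⟩
  h i ∎
  where open ≡-Reasoning

sumFin-indicator-just : ∀ {n} (i : Fin n) (h : Fin n → ℕ) →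
  sumFin (λ j → if ⌊ just j ≟V just i ⌋ then h j else 0) ≡ h i
sumFin-indicator-just i h = trans (sumFin-cong (λ j → cong (λ z → if z then h j else 0)
                          (trans (⌊just≟just⌋ j i) (⌊⌋-sym (j F.≟ i) (i F.≟ j))))) (sumFin-indicator i h)

sumV-indicator : ∀ {n} (v : Vtx n) (h : Vtx n → ℕ) →
  sumV (λ w → if ⌊ v ≟V w ⌋ then h w else 0) ≡ h v
sumV-indicator {n} nothing h =
  trans (cong₂ _+_ (cong (λ b → if b then h nothing else 0) (⌊⌋-true (_≟V_ {n} nothing nothing) refl))
                   (sumFin-zero _ (λ j → cong (λ b → if b then h (just j) else 0)
                                              (⌊⌋-false (_≟V_ {n} nothing (just j)) λ ()))))
        (+-identityʳ _)
sumV-indicator (just i) h =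
  cong₂ _+_ (cong (λ b → if b then h nothing else 0) (⌊⌋-false (just i ≟V nothing) λ ()))
            (trans (sumFin-cong (λ j → cong (λ b → if b then h (just j) else 0) (⌊just≟just⌋ i j)))
                   (sumFin-indicator i (λ j → h (just j))))

sumV-without : ∀ {n} → Vtx n → (Vtx n → ℕ) → ℕ
sumV-without nothing f = sumFin (λ j → f (just j))
sumV-without {suc n} (just i) f = f nothing + sumFin (λ j → f (just (punchIn i j)))

sumV-split : ∀ {n} (w : Vtx n) (f : Vtx n → ℕ) → sumV f ≡ f w + sumV-without w f
sumV-split nothing f = refl
sumV-split {suc n} (just i) f = sumV-punchIn i f

sumV-without-cong : ∀ {n} (w : Vtx n) {g h : Vtx n → ℕ} → (∀ u → u ≢ w → g u ≡ h u) →
  sumV-without w g ≡ sumV-without w h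
sumV-without-cong nothing e = sumFin-cong (λ j → e (just j) λ ())
sumV-without-cong {suc n} (just i) e =
  cong₂ _+_ (e nothing λ ())
            (sumFin-cong (λ j → e (just (punchIn i j)) (λ q → FP.punchInᵢ≢i i j (MP.just-injective q))))

sumV-agree-off : ∀ {n} (w : Vtx n) (g h : Vtx n → ℕ) → (∀ u → u ≢ w → g u ≡ h u) →
  sumV g + h w ≡ sumV h + g w
sumV-agree-off w g h e = begin
  sumV g + h w          ≡⟨ cong (_+ h w) (sumV-split w g) ⟩
  g w + R g + h w       ≡⟨ cong (λ z → g w + z + h w) (sumV-without-cong w e) ⟩
  g w + R h + h w       ≡⟨ +-assoc (g w) _ _ ⟩
  g w + (R h + h w)     ≡⟨ +-comm (g w) _ ⟩
  R h + h w + g w       ≡⟨ cong (_+ g w) (+-comm (R h) _) ⟩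
  h w + R h + g w       ≡⟨ cong (_+ g w) (sumV-split w h) ⟨
  sumV h + g w          ∎
  where
  open ≡-Reasoning
  R = sumV-without w

sumV-pred-at : ∀ {n} (t : Vtx n) (f g : Vtx n → ℕ) → (∀ w → w ≢ t → g w ≡ f w) → g t + 1 ≡ f t →
  sumV g + 1 ≡ sumV f
sumV-pred-at t f g e et = +-cancelʳ-≡ (g t) _ _ (begin
  sumV g + 1 + g t    ≡⟨ +-assoc (sumV g) 1 (g t) ⟩
  sumV g + (1 + g t)  ≡⟨ cong (sumV g +_) (trans (+-comm 1 (g t)) et) ⟩
  sumV g + f t        ≡⟨ sumV-agree-off t g f e ⟩
  sumV f + g t        ∎)
  where open ≡-Reasoning

sumV-except : ∀ {n} (w : Vtx n) (g : Vtx n → ℕ) →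
  sumV (λ u → if ⌊ u ≟V w ⌋ then 0 else g u) + g w ≡ sumV g
sumV-except w g = trans (sumV-agree-off w _ g off) (trans (cong (sumV g +_) at-w) (+-identityʳ _))
  where
  off : ∀ u → u ≢ w → (if ⌊ u ≟V w ⌋ then 0 else g u) ≡ g u
  off u u≢w rewrite ⌊⌋-false (u ≟V w) u≢w = refl
  at-w : (if ⌊ w ≟V w ⌋ then 0 else g w) ≡ 0
  at-w rewrite ⌊⌋-true (w ≟V w) refl = refl

choose-≤-sumFin : ∀ {n} (g : Fin n → ℕ) (k : ℕ) → k ≤ sumFin g →
  Σ (Fin n → ℕ) λ c → (∀ y → c y ≤ g y) × sumFin c ≡ k
choose-≤-sumFin {zero} g zero _ = (λ _ → 0) , (λ _ → z≤n) , refl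
choose-≤-sumFin {suc n} g k k≤ with choose-≤-sumFin (λ i → g (fsuc i)) (k ∸ (g fzero ⊓ k)) rest≤
  where
  rest≤ : k ∸ (g fzero ⊓ k) ≤ sumFin (λ i → g (fsuc i))
  rest≤ with ⊓-sel (g fzero) k
  ... | inj₁ e rewrite e = m≤n+o⇒m∸n≤o k (g fzero) k≤
  ... | inj₂ e rewrite e | n∸n≡0 k = z≤n
... | c , c≤ , Σc = c′ , c′≤ , trans (cong ((g fzero ⊓ k) +_) Σc) (m+[n∸m]≡n (m⊓n≤n (g fzero) k))
  where
  c′ : Fin (suc n) → ℕ
  c′ fzero = g fzero ⊓ k
  c′ (fsuc i) = c i
  c′≤ : ∀ y → c′ y ≤ g y
  c′≤ fzero = m⊓n≤m _ _
  c′≤ (fsuc i) = c≤ i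

-- sumV g is literally sumFin of g read on Fin (suc n), with fzero standing for the sink.
choose-≤-sumV : ∀ {n} (g : Vtx n → ℕ) (k : ℕ) → k ≤ sumV g →
  Σ (Vtx n → ℕ) λ c → (∀ y → c y ≤ g y) × sumV c ≡ k
choose-≤-sumV {n} g k k≤ with choose-≤-sumFin (g ∘ toVtx) k k≤
  where
  toVtx : Fin (suc n) → Vtx n
  toVtx fzero = nothing
  toVtx (fsuc i) = just i
... | c , c≤ , Σc = c′ , c′≤ , Σc
  where
  c′ : Vtx n → ℕ
  c′ nothing = c fzero
  c′ (just i) = c (fsuc i)
  c′≤ : ∀ y → c′ y ≤ g y
  c′≤ nothing = c≤ fzero
  c′≤ (just i) = c≤ (fsuc i)

-- Sto is a reflexive–transitive closure over functions; without function extensionality it is not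
-- closed under pointwise equality, so recurrence is tracked up to _≗_.
Sto≗ : ∀ {n} → Mult n → Config n → Set
Sto≗ {n} M η = Σ (Config n) λ η′ → η′ ≗ η × Sto M η′

TopStep-respˡ : ∀ {n} {M : Mult n} {η η₁ η′ : Config n} → η ≗ η₁ → TopStep M η η′ → TopStep M η₁ η′
TopStep-respˡ e (topple x lt c c≤ eq) =
  topple x (subst (_ <_) (e x) lt) c c≤ (λ v → trans (eq v) (cong (_+ _) (e v)))

Topplings-respˡ : ∀ {n} {M : Mult n} {η η₁ η′ : Config n} → η ≗ η₁ → Star (TopStep M) η η′ →
  Σ (Config n) λ η₁′ → η₁′ ≗ η′ × Star (TopStep M) η₁ η₁′
Topplings-respˡ {η₁ = η₁} e ε = η₁ , (λ v → sym (e v)) , ε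
Topplings-respˡ {η′ = η′} e (t ◅ ts) = η′ , (λ _ → refl) , (TopStep-respˡ e t ◅ ts)

addGrain-cong : ∀ {n} (x : Fin n) {η η₁ : Config n} → η ≗ η₁ → addGrain x η ≗ addGrain x η₁
addGrain-cong x e v with ⌊ v F.≟ x ⌋
... | true = cong suc (e v)
... | false = e v

Stable-resp : ∀ {n} {M : Mult n} {η η₁ : Config n} → η ≗ η₁ → Stable M η → Stable M η₁
Stable-resp {M = M} e s v = subst (_≤ deg M (just v)) (e v) (s v)

Trans-respˡ : ∀ {n} {M : Mult n} {η η₁ η′ : Config n} → η ≗ η₁ → Trans M η η′ →
  Σ (Config n) λ η₁′ → η₁′ ≗ η′ × Trans M η₁ η₁′
Trans-respˡ {M = M} e (x , ts , s) with Topplings-respˡ (addGrain-cong x e) ts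
... | η₁′ , e′ , ts′ = η₁′ , e′ , (x , ts′ , Stable-resp {M = M} (λ v → sym (e′ v)) s)

Sto≗-step : ∀ {n} {M : Mult n} {η η′ : Config n} → Sto≗ M η → Trans M η η′ → Sto≗ M η′
Sto≗-step (η₀ , e , s) t with Trans-respˡ (λ v → sym (e v)) t
... | η₀′ , e′ , t′ = η₀′ , e′ , (s ◅◅ (t′ ◅ ε))

Sto≗-resp : ∀ {n} {M : Mult n} {η η₁ : Config n} → η ≗ η₁ → Sto≗ M η → Sto≗ M η₁
Sto≗-resp e (η₀ , e₀ , s) = η₀ , (λ v → trans (e₀ v) (e v)) , s

Stable-Star : ∀ {n} {M : Mult n} {η η′ : Config n} → Star (Trans M) η η′ → Stable M η → Stable M η′
Stable-Star ε s = s
Stable-Star ((_ , _ , s′) ◅ ts) _ = Stable-Star ts s′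

Sto⇒Stable : ∀ {n} {M : Mult n} {η : Config n} → Sto M η → Stable M η
Sto⇒Stable s = Stable-Star s (λ v → ≤-refl)

-- Orientations along toppling sequences

module _ {n} {M : Mult n} (O : Orientation M) where
  open Orientation O

  outdeg : Vtx n → ℕ
  outdeg v = sumV (o v)

  outdeg+indeg≡deg : ∀ v → outdeg v + indeg O v ≡ deg M v
  outdeg+indeg≡deg v = trans (sym (sumV-+ (o v) (λ y → o y v))) (sumV-cong (split v))

  Orientation⇒Symmetric : Symmetric M
  Orientation⇒Symmetric u w = trans (sym (split u w)) (trans (+-comm (o u w) _) (split w u))

  o≤M : ∀ u w → o u w ≤ M u w
  o≤M u w = subst (o u w ≤_) (split u w) (m≤m+n _ _)

  o-loop≡0 : LoopFree M → ∀ v → o v v ≡ 0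
  o-loop≡0 lf v = m+n≡0⇒m≡0 (o v v) (trans (split v v) (lf v))

outdeg<η : ∀ {n} {M : Mult n} {η : Config n} (O : Orientation M) → Stable M η → Compatible M η O →
  ∀ v → suc (outdeg O (just v)) ≤ η v
outdeg<η {M = M} {η} O st cp v = +-cancelʳ-≤ (d ∸ η v) _ _ (begin
  suc out + (d ∸ η v)     ≡⟨ +-suc out (d ∸ η v) ⟨
  out + suc (d ∸ η v)     ≤⟨ +-monoʳ-≤ out (cp v) ⟩
  out + indeg O (just v)  ≡⟨ outdeg+indeg≡deg O (just v) ⟩
  d                       ≡⟨ m+[n∸m]≡n (st v) ⟨
  η v + (d ∸ η v)         ∎)
  where
  open ≤-Reasoning
  d = deg M (just v)
  out = outdeg O (just v)

-- The invariant maintained along a toppling sequence.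
CompatibleWhereStable : ∀ {n} (M : Mult n) → Config n → Orientation M → Set
CompatibleWhereStable M η O = ∀ v → η v ≤ deg M (just v) → suc (lvl M η v) ≤ indeg O (just v)

addGrain-≥ : ∀ {n} (x : Fin n) (η : Config n) v → η v ≤ addGrain x η v
addGrain-≥ x η v with ⌊ v F.≟ x ⌋
... | true = n≤1+n _
... | false = ≤-refl

addGrain-compatible : ∀ {n} {M : Mult n} {η : Config n} {O : Orientation M} (x : Fin n) →
  CompatibleWhereStable M η O → CompatibleWhereStable M (addGrain x η) O
addGrain-compatible {M = M} {η} x cp v η+≤d =
  ≤-trans (s≤s (∸-monoʳ-≤ (deg M (just v)) (addGrain-≥ x η v))) (cp v (≤-trans (addGrain-≥ x η v) η+≤d))

-- A toppling at x sending c y grains to y: reverse f y = min(o x y, c y) of the edges x → y.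
module Reorient {n} {M : Mult n} (lf : LoopFree M) (O : Orientation M) (x : Fin n)
                (c : Vtx n → ℕ) (c≤ : ∀ y → c y ≤ M (just x) y) where
  open Orientation O

  X : Vtx n
  X = just x

  f : Vtx n → ℕ
  f y = o X y ⊓ c y

  f≤o : ∀ y → f y ≤ o X y
  f≤o y = m⊓n≤m _ _

  kept : Vtx n → ℕ
  kept y = o X y ∸ f y

  o′ : Vtx n → Vtx n → ℕ
  o′ u w = if ⌊ u ≟V X ⌋ then o u w ∸ f w else (if ⌊ w ≟V X ⌋ then o u w + f u else o u w)

  split′ : ∀ u w → o′ u w + o′ w u ≡ M u w
  split′ u w with u ≟V X | w ≟V X
  ... | yes refl | yes refl = begin
        (o X X ∸ f X) + (o X X ∸ f X)  ≡⟨ cong (λ z → (z ∸ f X) + (z ∸ f X)) (o-loop≡0 O lf X) ⟩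
        (0 ∸ f X) + (0 ∸ f X)          ≡⟨ cong₂ _+_ (0∸n≡0 (f X)) (0∸n≡0 (f X)) ⟩
        0                              ≡⟨ lf X ⟨
        M X X                          ∎
        where open ≡-Reasoning
  ... | yes refl | no _ = begin
        (o X w ∸ f w) + (o w X + f w)  ≡⟨ cong ((o X w ∸ f w) +_) (+-comm (o w X) _) ⟩
        (o X w ∸ f w) + (f w + o w X)  ≡⟨ +-assoc (o X w ∸ f w) _ _ ⟨
        (o X w ∸ f w) + f w + o w X    ≡⟨ cong (_+ o w X) (m∸n+n≡m (f≤o w)) ⟩
        o X w + o w X                  ≡⟨ split X w ⟩
        M X w                          ∎
        where open ≡-Reasoning
  ... | no _ | yes refl = begin
        (o u X + f u) + (o X u ∸ f u)  ≡⟨ +-assoc (o u X) _ _ ⟩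
        o u X + (f u + (o X u ∸ f u))  ≡⟨ cong (o u X +_) (m+[n∸m]≡n (f≤o u)) ⟩
        o u X + o X u                  ≡⟨ split u X ⟩
        M u X                          ∎
        where open ≡-Reasoning
  ... | no _ | no _ = split u w

  O′ : Orientation M
  O′ = record { o = o′ ; split = split′ }

  indeg′-elsewhere : ∀ v → just v ≢ X → indeg O′ (just v) + f (just v) ≡ indeg O (just v)
  indeg′-elsewhere v v≢x = +-cancelʳ-≡ (o X (just v) ∸ f (just v)) _ _ (begin
    sumV g + f (just v) + (o X (just v) ∸ f (just v))    ≡⟨ +-assoc (sumV g) _ _ ⟩
    sumV g + (f (just v) + (o X (just v) ∸ f (just v)))  ≡⟨ cong (sumV g +_) (m+[n∸m]≡n (f≤o (just v))) ⟩
    sumV g + h X                                         ≡⟨ sumV-agree-off X g h agree ⟩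
    sumV h + g X                                         ≡⟨ cong (sumV h +_) at-X ⟩
    sumV h + (o X (just v) ∸ f (just v))                 ∎)
    where
    open ≡-Reasoning
    g = λ u → o′ u (just v)
    h = λ u → o u (just v)
    agree : ∀ u → u ≢ X → g u ≡ h u
    agree u u≢x rewrite ⌊⌋-false (u ≟V X) u≢x | ⌊⌋-false (just v ≟V X) v≢x = refl
    at-X : g X ≡ o X (just v) ∸ f (just v)
    at-X rewrite ⌊⌋-true (X ≟V X) refl = refl

  indeg′-at-x : indeg O′ X ≡ indeg O X + sumV f
  indeg′-at-x = trans (sumV-cong into-X) (sumV-+ (λ u → o u X) f)
    where
    into-X : ∀ u → o′ u X ≡ o u X + f u
    into-X u with u ≟V X
    ... | yes refl = trans (cong (_∸ f X) (o-loop≡0 O lf X))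
                           (trans (0∸n≡0 (f X)) (sym (cong (λ z → z + (z ⊓ c X)) (o-loop≡0 O lf X))))
    ... | no _ rewrite ⌊⌋-true (X ≟V X) refl = refl

  sent+kept≤M : ∀ y → c y + kept y ≤ M X y
  sent+kept≤M y with ⊓-sel (o X y) (c y)
  ... | inj₁ e rewrite e | n∸n≡0 (o X y) | +-identityʳ (c y) = c≤ y
  ... | inj₂ e rewrite e = subst (_≤ M X y) (sym (m+[n∸m]≡n (subst (_≤ o X y) e (m⊓n≤m (o X y) (c y)))))
                                 (o≤M O X y)

module _ {n} {M : Mult n} {η η′ : Config n} (lf : LoopFree M) (O : Orientation M)
         (x : Fin n) (lt : deg M (just x) < η x) (c : Vtx n → ℕ) (c≤ : ∀ y → c y ≤ M (just x) y)
         (eq : ∀ v → η′ v + (if ⌊ v F.≟ x ⌋ then sumV c else 0) ≡ η v + c (just v))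
         (cp : CompatibleWhereStable M η O) where
  open Reorient lf O x c c≤

  reoriented-compatible-elsewhere : ∀ v → v ≢ x → η′ v ≤ deg M (just v) →
    suc (lvl M η′ v) ≤ indeg O′ (just v)
  reoriented-compatible-elsewhere v v≢x η′≤d = +-cancelʳ-≤ cv _ _ (begin
    suc (d ∸ η′ v) + cv             ≡⟨ cong (λ z → suc (z + cv)) (trans (cong (d ∸_) η′≡) (sym (∸-+-assoc d (η v) cv))) ⟩
    suc ((d ∸ η v) ∸ cv + cv)       ≡⟨ cong suc (m∸n+n≡m cv≤) ⟩
    suc (d ∸ η v)                   ≤⟨ cp v η≤d ⟩
    indeg O (just v)                ≡⟨ indeg′-elsewhere v (λ q → v≢x (MP.just-injective q)) ⟨
    indeg O′ (just v) + f (just v)  ≤⟨ +-monoʳ-≤ (indeg O′ (just v)) (m⊓n≤n _ _) ⟩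
    indeg O′ (just v) + cv          ∎)
    where
    open ≤-Reasoning
    d = deg M (just v)
    cv = c (just v)
    η′≡ : η′ v ≡ η v + cv
    η′≡ = trans (sym (+-identityʳ (η′ v)))
                (subst (λ b → η′ v + (if b then sumV c else 0) ≡ η v + cv) (⌊⌋-false (v F.≟ x) v≢x) (eq v))
    η≤d : η v ≤ d
    η≤d = ≤-trans (subst (η v ≤_) (sym η′≡) (m≤m+n (η v) cv)) η′≤d
    cv≤ : cv ≤ d ∸ η v
    cv≤ = m+n≤o⇒m≤o∸n cv (subst (_≤ d) (trans η′≡ (+-comm (η v) cv)) η′≤d)

  reoriented-compatible-at-x : η′ x ≤ deg M (just x) → suc (lvl M η′ x) ≤ indeg O′ X
  reoriented-compatible-at-x η′≤d = +-cancelʳ-≤ K _ _ (begin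
    suc (d ∸ η′ x) + K          ≡⟨ +-suc (d ∸ η′ x) K ⟨
    (d ∸ η′ x) + suc K          ≤⟨ +-monoʳ-≤ (d ∸ η′ x) K<η′ ⟩
    (d ∸ η′ x) + η′ x           ≡⟨ m∸n+n≡m η′≤d ⟩
    d                           ≡⟨ outdeg+indeg≡deg O X ⟨
    outdeg O X + indeg O X      ≡⟨ cong (_+ indeg O X) out≡ ⟩
    sumV f + K + indeg O X      ≡⟨ +-comm (sumV f + K) _ ⟩
    indeg O X + (sumV f + K)    ≡⟨ +-assoc (indeg O X) _ _ ⟨
    indeg O X + sumV f + K      ≡⟨ cong (_+ K) indeg′-at-x ⟨
    indeg O′ X + K              ∎)
    where
    open ≤-Reasoning
    d = deg M X
    K = sumV kept
    cX≡0 : c X ≡ 0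
    cX≡0 = n≤0⇒n≡0 (subst (c X ≤_) (lf X) (c≤ X))
    η′+sent : η′ x + sumV c ≡ η x
    η′+sent = trans (subst (λ b → η′ x + (if b then sumV c else 0) ≡ η x + c X) (⌊⌋-true (x F.≟ x) refl) (eq x))
                    (trans (cong (η x +_) cX≡0) (+-identityʳ (η x)))
    out≡ : outdeg O X ≡ sumV f + K
    out≡ = trans (sumV-cong (λ y → sym (m+[n∸m]≡n (f≤o y)))) (sumV-+ f kept)
    K<η′ : suc K ≤ η′ x
    K<η′ = +-cancelʳ-≤ (sumV c) _ _ (subst (suc K + sumV c ≤_) (sym η′+sent)
                (≤-trans (s≤s (≤-trans (≤-reflexive (+-comm K _))
                                       (subst (_≤ d) (sumV-+ c kept) (sumV-mono sent+kept≤M)))) lt))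

TopStep-compatible : ∀ {n} {M : Mult n} {η η′ : Config n} (lf : LoopFree M) (O : Orientation M) →
  TopStep M η η′ → CompatibleWhereStable M η O → Σ (Orientation M) (CompatibleWhereStable M η′)
TopStep-compatible lf O (topple x lt c c≤ eq) cp = Reorient.O′ lf O x c c≤ , compat
  where
  compat : CompatibleWhereStable _ _ (Reorient.O′ lf O x c c≤)
  compat v = by-cases (v F.≟ x)
    where
    by-cases : Dec (v ≡ x) → _
    by-cases (yes refl) = reoriented-compatible-at-x lf O x lt c c≤ eq cp
    by-cases (no v≢x) = reoriented-compatible-elsewhere lf O x lt c c≤ eq cp v v≢x

Topplings-compatible : ∀ {n} {M : Mult n} {η η′ : Config n} (lf : LoopFree M) (O : Orientation M) →
  Star (TopStep M) η η′ → CompatibleWhereStable M η O → Σ (Orientation M) (CompatibleWhereStable M η′)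
Topplings-compatible lf O ε cp = O , cp
Topplings-compatible lf O (t ◅ ts) cp with TopStep-compatible lf O t cp
... | O′ , cp′ = Topplings-compatible lf O′ ts cp′

Transitions-compatible : ∀ {n} {M : Mult n} {η η′ : Config n} (lf : LoopFree M) (O : Orientation M) →
  Star (Trans M) η η′ → CompatibleWhereStable M η O → Σ (Orientation M) (CompatibleWhereStable M η′)
Transitions-compatible lf O ε cp = O , cp
Transitions-compatible {M = M} lf O ((x , ts , _) ◅ tss) cp
  with Topplings-compatible lf O ts (addGrain-compatible {M = M} {O = O} x cp)
... | O′ , cp′ = Transitions-compatible lf O′ tss cp′

Sto⇒compatible : ∀ {n} {M : Mult n} {η : Config n} (lf : LoopFree M) (O : Orientation M) →
  (∀ v → 1 ≤ indeg O (just v)) → Sto M η → Σ (Orientation M) (Compatible M η)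
Sto⇒compatible {M = M} lf O in≥1 s with Transitions-compatible lf O s at-ηmax
  where
  at-ηmax : CompatibleWhereStable M (ηmax M) O
  at-ηmax v _ = subst (λ z → suc z ≤ indeg O (just v)) (sym (n∸n≡0 (deg M (just v)))) (in≥1 v)
... | O′ , cp = O′ , λ v → cp v (Sto⇒Stable s v)

Reach-map : ∀ {n k} {M : Mult n} {M′ : Mult k} (π : Vtx n → Vtx k) →
  (∀ y z → 0 < M y z → π y ≡ π z ⊎ 0 < M′ (π y) (π z)) →
  ∀ {x v} → Reach M x v → Reach M′ (π x) (π v)
Reach-map π edge here = here
Reach-map π edge (step {y} {z} r p) with edge y z p
... | inj₁ e = subst (Reach _ _) e (Reach-map π edge r)
... | inj₂ q = step (Reach-map π edge r) q

Connected-map : ∀ {n k} {M : Mult n} {M′ : Mult k} (π : Vtx n → Vtx k) → π sink ≡ sink →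
  (∀ y z → 0 < M y z → π y ≡ π z ⊎ 0 < M′ (π y) (π z)) →
  (∀ j → Σ (Vtx n) λ v → π v ≡ just j) → Connected M → Connected M′
Connected-map π π-sink edge section cn nothing = here
Connected-map π π-sink edge section cn (just j) with section j
... | v , πv≡j = subst₂ (Reach _) π-sink πv≡j (Reach-map π edge (cn v))

sink-neighbour : ∀ {n} {M : Mult n} {i} → Reach M sink (just i) → Σ (Fin n) λ u → 0 < M sink (just u)
sink-neighbour (step {nothing} r p) = _ , p
sink-neighbour (step {just _} r _) = sink-neighbour r

-- The graph on W ∖ {u} obtained by identifying u with the sink; edges {u, s} become loops at s.
module MergeIntoSink {m} (M : Mult (suc m)) (u : Fin (suc m)) where
  U : Vtx (suc m)
  U = just u

  W : Fin m → Vtx (suc m)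
  W j = just (punchIn u j)

  merged : Mult m
  merged nothing nothing = 0
  merged nothing (just j) = M nothing (W j) + M U (W j)
  merged (just i) nothing = M (W i) nothing + M (W i) U
  merged (just i) (just j) = M (W i) (W j)

  merged-sym : Symmetric M → Symmetric merged
  merged-sym sy nothing nothing = refl
  merged-sym sy nothing (just j) = cong₂ _+_ (sy nothing (W j)) (sy U (W j))
  merged-sym sy (just i) nothing = cong₂ _+_ (sy (W i) nothing) (sy (W i) U)
  merged-sym sy (just i) (just j) = sy (W i) (W j)

  merged-loopFree : LoopFree M → LoopFree merged
  merged-loopFree lf nothing = refl
  merged-loopFree lf (just i) = lf (W i)

  deg-merged : ∀ i → deg merged (just i) ≡ deg M (W i)
  deg-merged i = begin
    (M (W i) nothing + M (W i) U) + S  ≡⟨ cong (_+ S) (+-comm (M (W i) nothing) _) ⟩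
    (M (W i) U + M (W i) nothing) + S  ≡⟨ +-assoc (M (W i) U) _ _ ⟩
    M (W i) U + (M (W i) nothing + S)  ≡⟨ sumV-punchIn u (M (W i)) ⟨
    deg M (W i)                        ∎
    where
    open ≡-Reasoning
    S = sumFin (λ j → M (W i) (W j))

  punchIn≢u : ∀ j → punchIn u j ≢ u
  punchIn≢u = FP.punchInᵢ≢i u

  punchOut-punchIn′ : ∀ j (u≢ : u ≢ punchIn u j) → punchOut u≢ ≡ j
  punchOut-punchIn′ j u≢ = trans (FP.punchOut-cong u refl) (FP.punchOut-punchIn u)

  u-or-punchIn : ∀ v → v ≡ u ⊎ Σ (Fin m) λ j → v ≡ punchIn u j
  u-or-punchIn v with u F.≟ v
  ... | yes e = inj₁ (sym e)
  ... | no u≢v = inj₂ (punchOut u≢v , sym (FP.punchIn-punchOut u≢v))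

  elim-u-punchIn : ∀ {ℓ} {P : Fin (suc m) → Set ℓ} → P u → (∀ j → P (punchIn u j)) → ∀ v → P v
  elim-u-punchIn {P = P} Pu Pj v with u-or-punchIn v
  ... | inj₁ e = subst P (sym e) Pu
  ... | inj₂ (j , e) = subst P (sym e) (Pj j)

  quotient : Vtx (suc m) → Vtx m
  quotient nothing = nothing
  quotient (just v) = by-cases (u F.≟ v)
    where
    by-cases : Dec (u ≡ v) → Vtx m
    by-cases (yes _) = nothing
    by-cases (no u≢v) = just (punchOut u≢v)

  quotient-U : quotient U ≡ nothing
  quotient-U with u F.≟ u
  ... | yes _ = refl
  ... | no u≢u = contradiction refl u≢u

  quotient-W : ∀ j → quotient (W j) ≡ just j
  quotient-W j with u F.≟ punchIn u j
  ... | yes e = contradiction (sym e) (punchIn≢u j)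
  ... | no u≢ = cong just (punchOut-punchIn′ j u≢)

  edge-quotient : ∀ y z → 0 < M y z → quotient y ≡ quotient z ⊎ 0 < merged (quotient y) (quotient z)
  edge-quotient nothing nothing p = inj₁ refl
  edge-quotient nothing (just w) p with u-or-punchIn w
  ... | inj₁ refl = inj₁ (sym quotient-U)
  ... | inj₂ (j , refl) rewrite quotient-W j = inj₂ (≤-trans p (m≤m+n _ _))
  edge-quotient (just v) nothing p with u-or-punchIn v
  ... | inj₁ refl = inj₁ quotient-U
  ... | inj₂ (i , refl) rewrite quotient-W i = inj₂ (≤-trans p (m≤m+n _ _))
  edge-quotient (just v) (just w) p with u-or-punchIn v | u-or-punchIn w
  ... | inj₁ refl | inj₁ refl = inj₁ refl
  ... | inj₁ refl | inj₂ (j , refl) rewrite quotient-U | quotient-W j = inj₂ (≤-trans p (m≤n+m _ _))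
  ... | inj₂ (i , refl) | inj₁ refl rewrite quotient-U | quotient-W i = inj₂ (≤-trans p (m≤n+m _ _))
  ... | inj₂ (i , refl) | inj₂ (j , refl) rewrite quotient-W i | quotient-W j = inj₂ p

  merged-connected : Connected M → Connected merged
  merged-connected = Connected-map quotient refl edge-quotient (λ j → W j , quotient-W j)

  -- Given c y ≤ o y u grains to move from each y to u: the edges from y into u turn into edges
  -- y → s, and c y of them are reversed.
  module OrientDown (O : Orientation M) (c : Vtx (suc m) → ℕ) (c≤ : ∀ y → c y ≤ Orientation.o O y U) where
    open Orientation O

    o↓ : Vtx m → Vtx m → ℕ
    o↓ nothing nothing = 0
    o↓ nothing (just j) = o nothing (W j) + o U (W j) + c (W j)
    o↓ (just i) nothing = o (W i) nothing + (o (W i) U ∸ c (W i))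
    o↓ (just i) (just j) = o (W i) (W j)

    split-sink : ∀ j → o↓ nothing (just j) + o↓ (just j) nothing ≡ merged nothing (just j)
    split-sink j = begin
      (a + b + c′) + (d + (e ∸ c′))    ≡⟨ cong (_+ (d + (e ∸ c′))) (+-assoc a b c′) ⟩
      (a + (b + c′)) + (d + (e ∸ c′))  ≡⟨ interchange a (b + c′) d (e ∸ c′) ⟩
      (a + d) + ((b + c′) + (e ∸ c′))  ≡⟨ cong ((a + d) +_) (+-assoc b c′ (e ∸ c′)) ⟩
      (a + d) + (b + (c′ + (e ∸ c′)))  ≡⟨ cong (λ z → (a + d) + (b + z)) (m+[n∸m]≡n (c≤ (W j))) ⟩
      (a + d) + (b + e)                ≡⟨ cong₂ _+_ (split nothing (W j)) (split U (W j)) ⟩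
      M nothing (W j) + M U (W j)      ∎
      where
      open ≡-Reasoning
      a = o nothing (W j)
      b = o U (W j)
      c′ = c (W j)
      d = o (W j) nothing
      e = o (W j) U

    split↓ : ∀ y z → o↓ y z + o↓ z y ≡ merged y z
    split↓ nothing nothing = refl
    split↓ nothing (just j) = split-sink j
    split↓ (just i) nothing = trans (+-comm (o↓ (just i) nothing) _)
      (trans (split-sink i) (merged-sym (Orientation⇒Symmetric O) nothing (just i)))
    split↓ (just i) (just j) = split (W i) (W j)

    O↓ : Orientation merged
    O↓ = record { o = o↓ ; split = split↓ }

    indeg-O↓ : ∀ j → indeg O↓ (just j) ≡ indeg O (W j) + c (W j)
    indeg-O↓ j = begin
      (a + b + c′) + S   ≡⟨ +-assoc (a + b) c′ S ⟩
      (a + b) + (c′ + S) ≡⟨ cong ((a + b) +_) (+-comm c′ S) ⟩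
      (a + b) + (S + c′) ≡⟨ +-assoc (a + b) S c′ ⟨
      (a + b) + S + c′   ≡⟨ cong (λ z → z + S + c′) (+-comm a b) ⟩
      (b + a) + S + c′   ≡⟨ cong (_+ c′) (+-assoc b a S) ⟩
      b + (a + S) + c′   ≡⟨ cong (_+ c′) (sumV-punchIn u (λ x → o x (W j))) ⟨
      indeg O (W j) + c′ ∎
      where
      open ≡-Reasoning
      a = o nothing (W j)
      b = o U (W j)
      c′ = c (W j)
      S = sumFin (λ i → o (W i) (W j))

  data Position : Vtx (suc m) → Set where
    at-sink : Position nothing
    at-u : Position U
    at-W : ∀ j → Position (W j)

  position : ∀ v → Position v
  position nothing = at-sink
  position (just v) with u-or-punchIn v
  ... | inj₁ refl = at-u
  ... | inj₂ (j , refl) = at-W j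

  position-U : position U ≡ at-u
  position-U with u-or-punchIn u
  ... | inj₁ refl = refl
  ... | inj₂ (j , e) = contradiction (sym e) (punchIn≢u j)

  position-W : ∀ j → position (W j) ≡ at-W j
  position-W j with u-or-punchIn (punchIn u j)
  ... | inj₁ e = contradiction e (punchIn≢u j)
  ... | inj₂ (i , e) with FP.punchIn-injective u j i e
  ... | refl with e
  ... | refl = refl

  -- Inverse direction: the edges y → s of the merged graph are routed first through {y, s}, the
  -- remainder through {y, u}; every edge {s, u} points to u.
  module OrientUp (sy : Symmetric M) (lf : LoopFree M) (Oₘ : Orientation merged) where
    open Orientation Oₘ renaming (o to oₘ)

    from-sink : Fin m → ℕ
    from-sink j = oₘ nothing (just j)

    Ms : Fin m → ℕ
    Ms j = M nothing (W j)

    o-pos : ∀ {y z} → Position y → Position z → ℕ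
    o-pos at-sink at-sink = 0
    o-pos at-sink at-u = M nothing U
    o-pos at-sink (at-W j) = from-sink j ⊓ Ms j
    o-pos at-u at-sink = 0
    o-pos at-u at-u = 0
    o-pos at-u (at-W j) = from-sink j ∸ Ms j
    o-pos (at-W i) at-sink = M (W i) nothing ∸ (from-sink i ⊓ Ms i)
    o-pos (at-W i) at-u = M (W i) U ∸ (from-sink i ∸ Ms i)
    o-pos (at-W i) (at-W j) = oₘ (just i) (just j)

    o↑ : Vtx (suc m) → Vtx (suc m) → ℕ
    o↑ y z = o-pos (position y) (position z)

    via-u≤ : ∀ j → from-sink j ∸ Ms j ≤ M (W j) U
    via-u≤ j = m≤n+o⇒m∸n≤o (from-sink j) (Ms j)
      (≤-trans (o≤M Oₘ nothing (just j)) (≤-reflexive (cong (Ms j +_) (sy U (W j)))))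

    via-sink≤ : ∀ j → from-sink j ⊓ Ms j ≤ M (W j) nothing
    via-sink≤ j = ≤-trans (m⊓n≤n (from-sink j) (Ms j)) (≤-reflexive (sy nothing (W j)))

    split-pos : ∀ {y z} (py : Position y) (pz : Position z) → o-pos py pz + o-pos pz py ≡ M y z
    split-pos at-sink at-sink = sym (lf nothing)
    split-pos at-sink at-u = +-identityʳ _
    split-pos at-sink (at-W j) =
      trans (+-comm (from-sink j ⊓ Ms j) _) (trans (m∸n+n≡m (via-sink≤ j)) (sy (W j) nothing))
    split-pos at-u at-sink = sy nothing U
    split-pos at-u at-u = sym (lf U)
    split-pos at-u (at-W j) = trans (m+[n∸m]≡n (via-u≤ j)) (sy (W j) U)
    split-pos (at-W i) at-sink = m∸n+n≡m (via-sink≤ i)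
    split-pos (at-W i) at-u = m∸n+n≡m (via-u≤ i)
    split-pos (at-W i) (at-W j) = split (just i) (just j)

    O↑ : Orientation M
    O↑ = record { o = o↑ ; split = λ y z → split-pos (position y) (position z) }

    indeg-O↑ : ∀ j → indeg O↑ (W j) ≡ indeg Oₘ (just j)
    indeg-O↑ j = begin
      indeg O↑ (W j)
        ≡⟨ sumV-punchIn u (λ x → o↑ x (W j)) ⟩
      o↑ U (W j) + (o↑ nothing (W j) + sumFin (λ i → o↑ (W i) (W j)))
        ≡⟨ cong₂ _+_ (cong₂ o-pos position-U (position-W j))
                     (cong₂ _+_ (cong (o-pos at-sink) (position-W j))
                                (sumFin-cong (λ i → cong₂ o-pos (position-W i) (position-W j)))) ⟩
      (from-sink j ∸ Ms j) + (from-sink j ⊓ Ms j + S)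
        ≡⟨ +-assoc (from-sink j ∸ Ms j) _ S ⟨
      (from-sink j ∸ Ms j) + (from-sink j ⊓ Ms j) + S
        ≡⟨ cong (_+ S) (m∸n+m⊓n≡m (from-sink j) (Ms j)) ⟩
      from-sink j + S ∎
      where
      open ≡-Reasoning
      S = sumFin (λ i → oₘ (just i) (just j))

    sink→u≤indeg : M nothing U ≤ indeg O↑ U
    sink→u≤indeg = subst (_≤ indeg O↑ U) (cong (o-pos at-sink) position-U) (term≤sumV (λ x → o↑ x U) nothing)

emptyOrientation : (M : Mult 0) → LoopFree M → Orientation M
emptyOrientation M lf = record { o = λ _ _ → 0 ; split = λ { nothing nothing → sym (lf nothing) } }

positive-indeg-orientation : ∀ n (M : Mult n) → Symmetric M → LoopFree M → Connected M →
  Σ (Orientation M) λ O → ∀ v → 1 ≤ indeg O (just v)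
positive-indeg-orientation zero M sy lf cn = emptyOrientation M lf , λ ()
positive-indeg-orientation (suc m) M sy lf cn with sink-neighbour (cn (just fzero))
... | u , s–u with positive-indeg-orientation m (MergeIntoSink.merged M u) (MergeIntoSink.merged-sym M u sy)
                    (MergeIntoSink.merged-loopFree M u lf) (MergeIntoSink.merged-connected M u cn)
... | Oₘ , in≥1 = O↑ , elim-u-punchIn (≤-trans s–u sink→u≤indeg) (λ j → subst (1 ≤_) (sym (indeg-O↑ j)) (in≥1 j))
  where
  open MergeIntoSink M u
  open OrientUp sy lf Oₘ

module Saturate {m} (M : Mult (suc m)) (u : Fin (suc m)) where
  open MergeIntoSink M u

  extend-at : Config m → ℕ → ∀ {y} → Position y → ℕ
  extend-at α t at-sink = 0
  extend-at α t at-u = t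
  extend-at α t (at-W j) = α j

  extend : Config m → ℕ → Config (suc m)
  extend α t v = extend-at α t (position (just v))

  extend-U : ∀ α t → extend α t u ≡ t
  extend-U α t = cong (extend-at α t) position-U

  extend-W : ∀ α t j → extend α t (punchIn u j) ≡ α j
  extend-W α t j = cong (extend-at α t) (position-W j)

  extend-cong : ∀ {α β : Config m} t → α ≗ β → extend α t ≗ extend β t
  extend-cong {α} {β} t e = elim-u-punchIn (trans (extend-U α t) (sym (extend-U β t)))
    (λ j → trans (extend-W α t j) (trans (e j) (sym (extend-W β t j))))

  ⌊punchIn≟punchIn⌋ : ∀ j x → ⌊ punchIn u j F.≟ punchIn u x ⌋ ≡ ⌊ j F.≟ x ⌋
  ⌊punchIn≟punchIn⌋ j x with j F.≟ x
  ... | yes refl = ⌊⌋-true (punchIn u j F.≟ punchIn u j) refl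
  ... | no j≢x = ⌊⌋-false (punchIn u j F.≟ punchIn u x) (λ e → j≢x (FP.punchIn-injective u j x e))

  ⌊u≟punchIn⌋ : ∀ x → ⌊ u F.≟ punchIn u x ⌋ ≡ false
  ⌊u≟punchIn⌋ x = ⌊⌋-false (u F.≟ punchIn u x) (λ e → punchIn≢u x (sym e))

  -- A toppling at x of the merged graph: the grains it sends to the merged sink go first along
  -- the edges {x, s}, the rest along {x, u}.
  module LiftToppling (x : Fin m) (c : Vtx m → ℕ) where
    lifted-at : ∀ {y} → Position y → ℕ
    lifted-at at-sink = c nothing ⊓ M (W x) nothing
    lifted-at at-u = c nothing ∸ M (W x) nothing
    lifted-at (at-W j) = c (just j)

    lifted : Vtx (suc m) → ℕ
    lifted y = lifted-at (position y)

    lifted-U : lifted U ≡ c nothing ∸ M (W x) nothing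
    lifted-U = cong lifted-at position-U

    lifted-W : ∀ j → lifted (W j) ≡ c (just j)
    lifted-W j = cong lifted-at (position-W j)

    sum-lifted : sumV lifted ≡ sumV c
    sum-lifted = begin
      sumV lifted
        ≡⟨ sumV-punchIn u lifted ⟩
      lifted U + (c nothing ⊓ M (W x) nothing + sumFin (λ j → lifted (W j)))
        ≡⟨ cong₂ _+_ lifted-U (cong (c nothing ⊓ M (W x) nothing +_) (sumFin-cong lifted-W)) ⟩
      (c nothing ∸ M (W x) nothing) + (c nothing ⊓ M (W x) nothing + sumFin (λ j → c (just j)))
        ≡⟨ +-assoc (c nothing ∸ M (W x) nothing) _ _ ⟨
      (c nothing ∸ M (W x) nothing) + (c nothing ⊓ M (W x) nothing) + sumFin (λ j → c (just j))
        ≡⟨ cong (_+ sumFin (λ j → c (just j))) (m∸n+m⊓n≡m (c nothing) (M (W x) nothing)) ⟩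
      sumV c ∎
      where open ≡-Reasoning

    lifted≤ : (∀ y → c y ≤ merged (just x) y) → ∀ y → lifted y ≤ M (W x) y
    lifted≤ c≤ nothing = m⊓n≤n _ _
    lifted≤ c≤ (just v) = elim-u-punchIn {P = λ v → lifted (just v) ≤ M (W x) (just v)}
      (subst (_≤ M (W x) U) (sym lifted-U) (m≤n+o⇒m∸n≤o _ _ (c≤ nothing)))
      (λ j → subst (_≤ M (W x) (W j)) (sym (lifted-W j)) (c≤ (just j))) v

  TopStep-extend : ∀ {β β′ : Config m} → TopStep merged β β′ → ∀ t →
    Σ ℕ λ k → TopStep M (extend β t) (extend β′ (t + k))
  TopStep-extend {β} {β′} (topple x lt c c≤ eq) t = k , topple (punchIn u x) lt′ lifted (lifted≤ c≤) eq′
    where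
    open LiftToppling x c
    k = lifted U
    lt′ : deg M (W x) < extend β t (punchIn u x)
    lt′ = subst₂ _<_ (deg-merged x) (sym (extend-W β t x)) lt
    eq-U : extend β′ (t + k) u + (if ⌊ u F.≟ punchIn u x ⌋ then sumV lifted else 0) ≡ extend β t u + lifted U
    eq-U rewrite extend-U β′ (t + k) | extend-U β t | ⌊u≟punchIn⌋ x = +-identityʳ (t + k)
    eq-W : ∀ j → extend β′ (t + k) (punchIn u j) + (if ⌊ punchIn u j F.≟ punchIn u x ⌋ then sumV lifted else 0)
                 ≡ extend β t (punchIn u j) + lifted (W j)
    eq-W j rewrite extend-W β′ (t + k) j | extend-W β t j | ⌊punchIn≟punchIn⌋ j x | sum-lifted | lifted-W j = eq j
    eq′ : ∀ v → extend β′ (t + k) v + (if ⌊ v F.≟ punchIn u x ⌋ then sumV lifted else 0) ≡ extend β t v + lifted (just v)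
    eq′ = elim-u-punchIn eq-U eq-W

  Topplings-extend : ∀ {β β′ : Config m} → Star (TopStep merged) β β′ → ∀ t →
    Σ ℕ λ t′ → t ≤ t′ × Star (TopStep M) (extend β t) (extend β′ t′)
  Topplings-extend ε t = t , ≤-refl , ε
  Topplings-extend (s ◅ ss) t with TopStep-extend s t
  ... | k , s′ with Topplings-extend ss (t + k)
  ... | t′ , t+k≤t′ , ss′ = t′ , ≤-trans (m≤m+n t k) t+k≤t′ , (s′ ◅ ss′)

  -- With an edge {u, s}, excess grains at u drain to the sink one toppling at a time.
  module Drain (u–s : 0 < M U nothing) where
    d = deg M U

    to-sink : Vtx (suc m) → ℕ
    to-sink nothing = 1
    to-sink (just _) = 0

    to-sink≤ : ∀ y → to-sink y ≤ M U y
    to-sink≤ nothing = u–s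
    to-sink≤ (just _) = z≤n

    sum-to-sink : sumV to-sink ≡ 1
    sum-to-sink = cong suc (sumFin-zero {suc m} _ (λ _ → refl))

    drain-step : ∀ (β : Config m) k → TopStep M (extend β (suc k + d)) (extend β (k + d))
    drain-step β k = topple u lt to-sink to-sink≤ (elim-u-punchIn eq-U eq-W)
      where
      lt : d < extend β (suc k + d) u
      lt = subst (d <_) (sym (extend-U β (suc k + d))) (s≤s (m≤n+m d k))
      eq-U : extend β (k + d) u + (if ⌊ u F.≟ u ⌋ then sumV to-sink else 0) ≡ extend β (suc k + d) u + 0
      eq-U rewrite extend-U β (k + d) | extend-U β (suc k + d) | ⌊⌋-true (u F.≟ u) refl | sum-to-sink =
        trans (+-comm (k + d) 1) (sym (+-identityʳ _))
      eq-W : ∀ j → extend β (k + d) (punchIn u j) + (if ⌊ punchIn u j F.≟ u ⌋ then sumV to-sink else 0)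
                   ≡ extend β (suc k + d) (punchIn u j) + 0
      eq-W j rewrite extend-W β (k + d) j | extend-W β (suc k + d) j | ⌊⌋-false (punchIn u j F.≟ u) (punchIn≢u j) = refl

    drain : ∀ (β : Config m) k → Star (TopStep M) (extend β (k + d)) (extend β d)
    drain β zero = ε
    drain β (suc k) = drain-step β k ◅ drain β k

    extend-addGrain : ∀ (α : Config m) x → extend (addGrain x α) d ≗ addGrain (punchIn u x) (extend α d)
    extend-addGrain α x = elim-u-punchIn at-U at-W′
      where
      at-U : extend (addGrain x α) d u ≡ addGrain (punchIn u x) (extend α d) u
      at-U rewrite extend-U (addGrain x α) d | ⌊u≟punchIn⌋ x | extend-U α d = refl
      at-W′ : ∀ j → extend (addGrain x α) d (punchIn u j) ≡ addGrain (punchIn u x) (extend α d) (punchIn u j)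
      at-W′ j rewrite extend-W (addGrain x α) d j | ⌊punchIn≟punchIn⌋ j x | extend-W α d j = refl

    extend-stable : ∀ (α : Config m) → Stable merged α → Stable M (extend α d)
    extend-stable α st = elim-u-punchIn (≤-reflexive (extend-U α d))
      (λ j → subst₂ _≤_ (sym (extend-W α d j)) (deg-merged j) (st j))

    Trans-extend : ∀ {α α′ : Config m} → Trans merged α α′ →
      Σ (Config (suc m)) λ η → η ≗ extend α′ d × Trans M (extend α d) η
    Trans-extend {α} {α′} (x , ts , st) with Topplings-extend ts d
    ... | t′ , d≤t′ , ts′ with Topplings-respˡ (extend-addGrain α x) (ts′ ◅◅ drained)
      where
      drained : Star (TopStep M) (extend α′ t′) (extend α′ d)
      drained = subst (λ z → Star (TopStep M) (extend α′ z) (extend α′ d)) (m∸n+n≡m d≤t′) (drain α′ (t′ ∸ d))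
    ... | η , e , ts″ = η , e , (punchIn u x , ts″ , Stable-resp {M = M} (λ v → sym (e v)) (extend-stable α′ st))

    Transitions-extend : ∀ {α α′ : Config m} → Star (Trans merged) α α′ → Sto≗ M (extend α d) → Sto≗ M (extend α′ d)
    Transitions-extend ε s = s
    Transitions-extend (t ◅ ts) s with Trans-extend t
    ... | η , e , t′ = Transitions-extend ts (Sto≗-resp e (Sto≗-step s t′))

    extend-Sto : ∀ {ζ : Config m} → Sto≗ merged ζ → Sto≗ M (extend ζ d)
    extend-Sto (ζ′ , e , s) = Sto≗-resp (extend-cong d e) (Transitions-extend s from-ηmax)
      where
      from-ηmax : Sto≗ M (extend (ηmax merged) d)
      from-ηmax = ηmax M , elim-u-punchIn (sym (extend-U (ηmax merged) d))
                                          (λ j → trans (sym (deg-merged j)) (sym (extend-W (ηmax merged) d j))) , ε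

-- Stable configurations with a compatible orientation are recurrent

-- One step of the induction behind compatible⇒Sto: u is a neighbour of the sink, and c selects
-- lvl η u + 1 of the edges oriented into u (possible by compatibility at u).  Removing these c-grains
-- gives a compatible configuration ζ of the merged graph; η arises from the saturated extension of ζ
-- by adding a grain at u and toppling u once along the selected edges.
module RecurrenceStep {m} (M : Mult (suc m)) (sy : Symmetric M) (lf : LoopFree M)
   (η : Config (suc m)) (st : Stable M η) (O : Orientation M) (cp : Compatible M η O)
   (u : Fin (suc m)) (s–u : 0 < M sink (just u))
   (c : Vtx (suc m) → ℕ) (c≤ : ∀ y → c y ≤ Orientation.o O y (just u)) (Σc : sumV c ≡ suc (lvl M η u))
   (recurrent : ∀ ζ → Stable (MergeIntoSink.merged M u) ζ → (O′ : Orientation (MergeIntoSink.merged M u)) →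
                Compatible (MergeIntoSink.merged M u) ζ O′ → Sto≗ (MergeIntoSink.merged M u) ζ) where
  open MergeIntoSink M u
  open Saturate M u
  open Drain (subst (0 <_) (sy nothing U) s–u)
  open Orientation O
  open OrientDown O c c≤

  ζ : Config m
  ζ j = η (punchIn u j) ∸ c (W j)

  c≤η : ∀ j → c (W j) ≤ η (punchIn u j)
  c≤η j = ≤-trans (≤-trans (c≤ (W j)) (term≤sumV (o (W j)) U))
                  (≤-trans (n≤1+n _) (outdeg<η O st cp (punchIn u j)))

  ζ-stable : Stable merged ζ
  ζ-stable j = ≤-trans (m∸n≤m (η (punchIn u j)) (c (W j))) (subst (η (punchIn u j) ≤_) (sym (deg-merged j)) (st (punchIn u j)))

  ζ-compatible : Compatible merged ζ O↓
  ζ-compatible j = subst (λ z → suc z ≤ indeg O↓ (just j)) (sym lvl≡)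
                         (subst (suc ((dⱼ ∸ ηⱼ) + c′) ≤_) (sym (indeg-O↓ j)) (+-monoˡ-≤ c′ (cp (punchIn u j))))
    where
    open ≡-Reasoning
    dⱼ = deg M (W j)
    ηⱼ = η (punchIn u j)
    c′ = c (W j)
    lvl≡ : lvl merged ζ j ≡ (dⱼ ∸ ηⱼ) + c′
    lvl≡ = begin
      deg merged (just j) ∸ (ηⱼ ∸ c′)              ≡⟨ cong (_∸ (ηⱼ ∸ c′)) (deg-merged j) ⟩
      dⱼ ∸ (ηⱼ ∸ c′)                                ≡⟨ cong (_∸ (ηⱼ ∸ c′)) (m+[n∸m]≡n (st (punchIn u j))) ⟨
      (ηⱼ + (dⱼ ∸ ηⱼ)) ∸ (ηⱼ ∸ c′)                    ≡⟨ cong (λ z → (z + (dⱼ ∸ ηⱼ)) ∸ (ηⱼ ∸ c′)) (m∸n+n≡m (c≤η j)) ⟨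
      ((ηⱼ ∸ c′) + c′ + (dⱼ ∸ ηⱼ)) ∸ (ηⱼ ∸ c′)        ≡⟨ cong (_∸ (ηⱼ ∸ c′)) (+-assoc (ηⱼ ∸ c′) c′ (dⱼ ∸ ηⱼ)) ⟩
      ((ηⱼ ∸ c′) + (c′ + (dⱼ ∸ ηⱼ))) ∸ (ηⱼ ∸ c′)      ≡⟨ m+n∸m≡n (ηⱼ ∸ c′) _ ⟩
      c′ + (dⱼ ∸ ηⱼ)                                ≡⟨ +-comm c′ (dⱼ ∸ ηⱼ) ⟩
      (dⱼ ∸ ηⱼ) + c′                                ∎

  c-U≡0 : c U ≡ 0
  c-U≡0 = n≤0⇒n≡0 (subst (c U ≤_) (o-loop≡0 O lf U) (c≤ U))

  topple-u : TopStep M (addGrain u (extend ζ d)) η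
  topple-u = topple u lt c (λ y → ≤-trans (c≤ y) (subst (o y U ≤_) (sy y U) (o≤M O y U))) (elim-u-punchIn eq-U eq-W)
    where
    lt : d < addGrain u (extend ζ d) u
    lt rewrite ⌊⌋-true (u F.≟ u) refl | extend-U ζ d = n<1+n d
    eq-U : η u + (if ⌊ u F.≟ u ⌋ then sumV c else 0) ≡ addGrain u (extend ζ d) u + c U
    eq-U rewrite ⌊⌋-true (u F.≟ u) refl | Σc | extend-U ζ d | c-U≡0 =
      trans (+-suc (η u) _) (trans (cong suc (m+[n∸m]≡n (st u))) (sym (+-identityʳ _)))
    eq-W : ∀ j → η (punchIn u j) + (if ⌊ punchIn u j F.≟ u ⌋ then sumV c else 0)
                 ≡ addGrain u (extend ζ d) (punchIn u j) + c (W j)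
    eq-W j rewrite ⌊⌋-false (punchIn u j F.≟ u) (punchIn≢u j) | extend-W ζ d j =
      trans (+-identityʳ _) (sym (m∸n+n≡m (c≤η j)))

  η-recurrent : Sto≗ M η
  η-recurrent = Sto≗-step (extend-Sto (recurrent ζ ζ-stable O↓ ζ-compatible)) (u , topple-u ◅ ε , st)

compatible⇒Sto : ∀ n (M : Mult n) → Symmetric M → LoopFree M → Connected M →
  ∀ (η : Config n) → Stable M η → (O : Orientation M) → Compatible M η O → Sto≗ M η
compatible⇒Sto zero M sy lf cn η st O cp = ηmax M , (λ ()) , ε
compatible⇒Sto (suc m) M sy lf cn η st O cp with sink-neighbour (cn (just fzero))
... | u , s–u with choose-≤-sumV (λ y → Orientation.o O y (just u)) (suc (lvl M η u)) (cp u)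
... | c , c≤ , Σc = RecurrenceStep.η-recurrent M sy lf η st O cp u s–u c c≤ Σc
       (compatible⇒Sto m (MergeIntoSink.merged M u) (MergeIntoSink.merged-sym M u sy)
                         (MergeIntoSink.merged-loopFree M u lf) (MergeIntoSink.merged-connected M u cn))

-- Deletion of an edge

module Deletion {n} (M : Mult n) (a b : Fin n) (a≢b : a ≢ b) where
  A B : Vtx n
  A = just a
  B = just b

  A≢B : A ≢ B
  A≢B e = a≢b (MP.just-injective e)

  B≢A : B ≢ A
  B≢A e = A≢B (sym e)

  isArc : Vtx n → Vtx n → Bool
  isArc x y = ⌊ x ≟V A ⌋ ∧ ⌊ y ≟V B ⌋

  isPair-AB : isPair A B A B ≡ true
  isPair-AB rewrite ⌊⌋-true (A ≟V A) refl | ⌊⌋-true (B ≟V B) refl = refl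

  isPair-BA : isPair A B B A ≡ true
  isPair-BA rewrite ⌊⌋-false (B ≟V A) B≢A | ⌊⌋-true (B ≟V B) refl | ⌊⌋-true (A ≟V A) refl = refl

  isArc-AB : isArc A B ≡ true
  isArc-AB rewrite ⌊⌋-true (A ≟V A) refl | ⌊⌋-true (B ≟V B) refl = refl

  isArc-BA : isArc B A ≡ false
  isArc-BA rewrite ⌊⌋-false (B ≟V A) B≢A = refl

  OffPair : Vtx n → Vtx n → Set
  OffPair x y = isPair A B x y ≡ false × isArc x y ≡ false × isArc y x ≡ false

  pair-cases : ∀ x y → (x ≡ A × y ≡ B) ⊎ (x ≡ B × y ≡ A) ⊎ OffPair x y
  pair-cases x y = go (x ≟V A) (y ≟V B) (x ≟V B) (y ≟V A)
    where
    go : Dec (x ≡ A) → Dec (y ≡ B) → Dec (x ≡ B) → Dec (y ≡ A) → (x ≡ A × y ≡ B) ⊎ (x ≡ B × y ≡ A) ⊎ OffPair x y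
    go (yes x≡A) (yes y≡B) _ _ = inj₁ (x≡A , y≡B)
    go _ _ (yes x≡B) (yes y≡A) = inj₂ (inj₁ (x≡B , y≡A))
    go (yes x≡A) (no _) (yes x≡B) _ = ⊥-elim (A≢B (trans (sym x≡A) x≡B))
    go (yes x≡A) (no y≢B) (no x≢B) _
      rewrite ⌊⌋-true (x ≟V A) x≡A | ⌊⌋-false (y ≟V B) y≢B | ⌊⌋-false (x ≟V B) x≢B = inj₂ (inj₂ (refl , refl , ∧-zeroʳ _))
    go (no x≢A) _ (yes x≡B) (no y≢A)
      rewrite ⌊⌋-false (x ≟V A) x≢A | ⌊⌋-false (y ≟V A) y≢A | ⌊⌋-true (x ≟V B) x≡B = inj₂ (inj₂ (refl , refl , refl))
    go (no x≢A) _ (no x≢B) _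
      rewrite ⌊⌋-false (x ≟V A) x≢A | ⌊⌋-false (x ≟V B) x≢B = inj₂ (inj₂ (refl , refl , ∧-zeroʳ _))

  isPair-sym : ∀ x y → isPair A B x y ≡ isPair A B y x
  isPair-sym x y = trans (cong₂ _∨_ (∧-comm ⌊ x ≟V A ⌋ ⌊ y ≟V B ⌋) (∧-comm ⌊ x ≟V B ⌋ ⌊ y ≟V A ⌋))
                         (∨-comm (⌊ y ≟V B ⌋ ∧ ⌊ x ≟V A ⌋) (⌊ y ≟V A ⌋ ∧ ⌊ x ≟V B ⌋))

  M∖e : Mult n
  M∖e = delete M a b

  delete-sym : Symmetric M → Symmetric M∖e
  delete-sym sy x y = cong₂ _∸_ (sy x y) (cong (λ z → if z then 1 else 0) (isPair-sym x y))

  delete-loopFree : LoopFree M → LoopFree M∖e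
  delete-loopFree lf x = trans (cong (_∸ (if isPair A B x x then 1 else 0)) (lf x)) (0∸n≡0 (if isPair A B x x then 1 else 0))

  delete-off-pair : ∀ x y → ¬ (x ≡ A × y ≡ B) → ¬ (x ≡ B × y ≡ A) → M∖e x y ≡ M x y
  delete-off-pair x y not-AB not-BA with pair-cases x y
  ... | inj₁ p = ⊥-elim (not-AB p)
  ... | inj₂ (inj₁ p) = ⊥-elim (not-BA p)
  ... | inj₂ (inj₂ (off , _ , _)) rewrite off = refl

  deg-delete-a : 1 ≤ M A B → deg M∖e A + 1 ≡ deg M A
  deg-delete-a 1≤ = sumV-pred-at B (M A) (M∖e A)
    (λ w w≢B → delete-off-pair A w (λ p → w≢B (proj₂ p)) (λ p → A≢B (proj₁ p)))
    (subst (λ z → (M A B ∸ (if z then 1 else 0)) + 1 ≡ M A B) (sym isPair-AB) (m∸n+n≡m 1≤))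

  deg-delete-b : 1 ≤ M B A → deg M∖e B + 1 ≡ deg M B
  deg-delete-b 1≤ = sumV-pred-at A (M B) (M∖e B)
    (λ w w≢A → delete-off-pair B w (λ p → B≢A (proj₁ p)) (λ p → w≢A (proj₂ p)))
    (subst (λ z → (M B A ∸ (if z then 1 else 0)) + 1 ≡ M B A) (sym isPair-BA) (m∸n+n≡m 1≤))

  deg-delete-other : ∀ v → v ≢ a → v ≢ b → deg M∖e (just v) ≡ deg M (just v)
  deg-delete-other v v≢a v≢b = sumV-cong (λ w → delete-off-pair (just v) w
    (λ p → v≢a (MP.just-injective (proj₁ p))) (λ p → v≢b (MP.just-injective (proj₁ p))))

  module DropArc (O : Orientation M) (a→b : 1 ≤ Orientation.o O A B) where
    open Orientation O

    o∖ : Vtx n → Vtx n → ℕ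
    o∖ x y = o x y ∸ (if isArc x y then 1 else 0)

    split∖ : ∀ x y → o∖ x y + o∖ y x ≡ M∖e x y
    split∖ x y with pair-cases x y
    ... | inj₁ (refl , refl) rewrite isArc-AB | isArc-BA =
          trans (sym (+-∸-comm (o B A) a→b)) (cong (_∸ 1) (split A B))
    ... | inj₂ (inj₁ (refl , refl)) rewrite isPair-BA | isArc-AB | isArc-BA =
          trans (sym (+-∸-assoc (o B A) a→b)) (cong (_∸ 1) (split B A))
    ... | inj₂ (inj₂ (off , x↛y , y↛x)) rewrite off | x↛y | y↛x = split x y

    O∖ : Orientation M∖e
    O∖ = record { o = o∖ ; split = split∖ }

    o∖-off-arc : ∀ x y → ¬ (x ≡ A × y ≡ B) → o∖ x y ≡ o x y
    o∖-off-arc x y not-AB with pair-cases x y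
    ... | inj₁ p = ⊥-elim (not-AB p)
    ... | inj₂ (inj₁ (refl , refl)) rewrite isArc-BA = refl
    ... | inj₂ (inj₂ (_ , x↛y , _)) rewrite x↛y = refl

    indeg-drop-b : indeg O∖ B + 1 ≡ indeg O B
    indeg-drop-b = sumV-pred-at A (λ x → o x B) (λ x → o∖ x B)
      (λ x x≢A → o∖-off-arc x B (λ p → x≢A (proj₁ p)))
      (subst (λ z → (o A B ∸ (if z then 1 else 0)) + 1 ≡ o A B) (sym isArc-AB) (m∸n+n≡m a→b))

    indeg-drop-other : ∀ v → v ≢ b → indeg O∖ (just v) ≡ indeg O (just v)
    indeg-drop-other v v≢b = sumV-cong (λ x → o∖-off-arc x (just v) (λ p → v≢b (MP.just-injective (proj₂ p))))

[m+1]∸[n+1]≡m∸n : ∀ x y → (x + 1) ∸ (y + 1) ≡ x ∸ y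
[m+1]∸[n+1]≡m∸n x y rewrite +-comm x 1 | +-comm y 1 = refl

-- Case (A): the grain removed from a pays for the deleted edge at a, and the deleted edge a → b,
-- missing at b, is paid for by l_η(b) > 0.
module CaseA {n} (M : Mult n) (a b : Fin n) (a≢b : a ≢ b) (sy : Symmetric M) (lf : LoopFree M)
  (a–b : 1 ≤ M (just a) (just b)) (cn∖e : Connected (delete M a b))
  (η : Config n) (st : Stable M η) (l-b>0 : 0 < lvl M η b) (O : Orientation M) (cp : Compatible M η O)
  (a→b : 1 ≤ Orientation.o O (just a) (just b)) where
  open Deletion M a b a≢b
  open DropArc O a→b

  ζ : Config n
  ζ v = η v ∸ (if ⌊ v F.≟ a ⌋ then 1 else 0)

  ζ-a : ζ a + 1 ≡ η a
  ζ-a rewrite ⌊⌋-true (a F.≟ a) refl = m∸n+n≡m (≤-trans (s≤s z≤n) (outdeg<η O st cp a))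

  ζ-other : ∀ v → v ≢ a → ζ v ≡ η v
  ζ-other v v≢a rewrite ⌊⌋-false (v F.≟ a) v≢a = refl

  b–a : 1 ≤ M B A
  b–a = subst (1 ≤_) (sy A B) a–b

  η-b+1≤ : η b + 1 ≤ deg M B
  η-b+1≤ = ≤-trans (+-monoʳ-≤ (η b) l-b>0) (≤-reflexive (m+[n∸m]≡n (st b)))

  η-b≤ : η b ≤ deg M∖e B
  η-b≤ = +-cancelʳ-≤ 1 _ _ (subst (η b + 1 ≤_) (sym (deg-delete-b b–a)) η-b+1≤)

  ζ-stable : Stable M∖e ζ
  ζ-stable v = by-cases (v F.≟ a) (v F.≟ b)
    where
    by-cases : Dec (v ≡ a) → Dec (v ≡ b) → ζ v ≤ deg M∖e (just v)
    by-cases (yes refl) _ = +-cancelʳ-≤ 1 _ _ (subst₂ _≤_ (sym ζ-a) (sym (deg-delete-a a–b)) (st a))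
    by-cases (no v≢a) (yes refl) = subst (_≤ deg M∖e B) (sym (ζ-other b v≢a)) η-b≤
    by-cases (no v≢a) (no v≢b) = subst₂ _≤_ (sym (ζ-other v v≢a)) (sym (deg-delete-other v v≢a v≢b)) (st v)

  lvl-a : lvl M∖e ζ a ≡ lvl M η a
  lvl-a = trans (sym ([m+1]∸[n+1]≡m∸n (deg M∖e A) (ζ a))) (cong₂ _∸_ (deg-delete-a a–b) ζ-a)

  compatible-b : b ≢ a → suc (lvl M∖e ζ b) ≤ indeg O∖ B
  compatible-b b≢a = +-cancelʳ-≤ 1 _ _ (begin
    suc (deg M∖e B ∸ ζ b) + 1     ≡⟨ cong (λ z → suc (deg M∖e B ∸ z) + 1) (ζ-other b b≢a) ⟩
    suc (deg M∖e B ∸ η b) + 1     ≡⟨ cong suc (+-∸-comm 1 η-b≤) ⟨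
    suc ((deg M∖e B + 1) ∸ η b)   ≡⟨ cong (λ z → suc (z ∸ η b)) (deg-delete-b b–a) ⟩
    suc (deg M B ∸ η b)           ≤⟨ cp b ⟩
    indeg O B                     ≡⟨ indeg-drop-b ⟨
    indeg O∖ B + 1                ∎)
    where open ≤-Reasoning

  ζ-compatible : Compatible M∖e ζ O∖
  ζ-compatible v = by-cases (v F.≟ a) (v F.≟ b)
    where
    by-cases : Dec (v ≡ a) → Dec (v ≡ b) → suc (lvl M∖e ζ v) ≤ indeg O∖ (just v)
    by-cases (yes refl) _ = subst₂ (λ x y → suc x ≤ y) (sym lvl-a) (sym (indeg-drop-other a a≢b)) (cp a)
    by-cases (no v≢a) (yes refl) = compatible-b v≢a
    by-cases (no v≢a) (no v≢b) = subst₂ (λ x y → suc x ≤ y)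
      (sym (cong₂ _∸_ (deg-delete-other v v≢a v≢b) (ζ-other v v≢a))) (sym (indeg-drop-other v v≢b)) (cp v)

  result : Σ (Config n) λ ζ → Sto (delete M a b) ζ × ζ a + 1 ≡ η a × (∀ v → v ≢ a → ζ v ≡ η v)
  result with compatible⇒Sto n M∖e (delete-sym sy) (delete-loopFree lf) cn∖e ζ ζ-stable O∖ ζ-compatible
  ... | ζ′ , ζ′≗ζ , s′ = ζ′ , s′ , trans (cong (_+ 1) (ζ′≗ζ a)) ζ-a , λ v v≢a → trans (ζ′≗ζ v) (ζ-other v v≢a)
-- Contraction of an edge

if-∧ : ∀ (p q : Bool) (f : ℕ) → (if p ∧ q then f else 0) ≡ (if p then (if q then f else 0) else 0)
if-∧ true q f = refl
if-∧ false q f = refl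

if-then-sumV : ∀ {n} (p : Bool) (g : Vtx n → ℕ) → (if p then sumV g else 0) ≡ sumV (λ y → if p then g y else 0)
if-then-sumV {n} true g = refl
if-then-sumV {n} false g = sym (sumV-zero {n} (λ _ → 0) (λ _ → refl))

if-+ : ∀ (p : Bool) x y → (if p then x else 0) + (if p then y else 0) ≡ (if p then x + y else 0)
if-+ true x y = refl
if-+ false x y = refl

if-else-+ : ∀ (p : Bool) x y → (if p then 0 else x + y) ≡ (if p then 0 else x) + (if p then 0 else y)
if-else-+ true x y = refl
if-else-+ false x y = refl

if-0-0 : ∀ (p : Bool) → (if p then 0 else 0) ≡ 0
if-0-0 true = refl
if-0-0 false = refl

-- contractM M is definitionally contractWith M sinkEdges below.
module ContractionFacts {m} (M : Mult (suc m)) (a b : Fin (suc m)) (a≢b : a ≢ b) where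
  open Contraction M a b a≢b
  open ≡-Reasoning

  A B : Vtx (suc m)
  A = just a
  B = just b

  AB : Vtx m
  AB = just ab

  W : Fin m → Vtx (suc m)
  W j = just (punchIn b j)

  π-B : π B ≡ AB
  π-B with b F.≟ b
  ... | yes _ = refl
  ... | no b≢b = contradiction refl b≢b

  π-W : ∀ j → π (W j) ≡ just j
  π-W j with punchIn b j F.≟ b
  ... | yes e = contradiction e (FP.punchInᵢ≢i b j)
  ... | no _ = cong just (trans (FP.punchOut-cong b refl) (FP.punchOut-punchIn b))

  W-ab : W ab ≡ A
  W-ab = cong just (FP.punchIn-punchOut b≢a)

  inFibre : Vtx m → (Vtx (suc m) → ℕ) → Vtx (suc m) → ℕ
  inFibre w h y = if ⌊ π y ≟V w ⌋ then h y else 0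

  fibre-sum : ∀ (w : Vtx m) (h : Vtx (suc m) → ℕ) →
    sumV (inFibre w h) ≡
    (if ⌊ AB ≟V w ⌋ then h B else 0) + ((if ⌊ nothing ≟V w ⌋ then h nothing else 0) +
      sumFin (λ j → if ⌊ just j ≟V w ⌋ then h (W j) else 0))
  fibre-sum w h = trans (sumV-punchIn b (inFibre w h))
    (cong₂ _+_ (cong (λ z → if ⌊ z ≟V w ⌋ then h B else 0) π-B)
       (cong ((if ⌊ nothing ≟V w ⌋ then h nothing else 0) +_)
         (sumFin-cong (λ j → cong (λ z → if ⌊ z ≟V w ⌋ then h (W j) else 0) (π-W j)))))

  fibre-sum-ab : ∀ (h : Vtx (suc m) → ℕ) → sumV (inFibre AB h) ≡ h A + h B
  fibre-sum-ab h = begin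
    sumV (inFibre AB h) ≡⟨ fibre-sum AB h ⟩
    (if ⌊ AB ≟V AB ⌋ then h B else 0) + ((if ⌊ nothing ≟V AB ⌋ then h nothing else 0) +
      sumFin (λ j → if ⌊ just j ≟V AB ⌋ then h (W j) else 0))
      ≡⟨ cong₂ _+_ (cong (λ z → if z then h B else 0) (⌊⌋-true (AB ≟V AB) refl))
           (cong₂ _+_ (cong (λ z → if z then h nothing else 0) (⌊⌋-false (nothing ≟V AB) (λ ())))
              (sumFin-indicator-just ab (λ j → h (W j)))) ⟩
    h B + (0 + h (W ab)) ≡⟨ cong (λ z → h B + h z) W-ab ⟩
    h B + h A ≡⟨ +-comm (h B) (h A) ⟩
    h A + h B ∎

  fibre-sum-other : ∀ j → j ≢ ab → ∀ (h : Vtx (suc m) → ℕ) → sumV (inFibre (just j) h) ≡ h (W j)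
  fibre-sum-other j j≢ab h = begin
    sumV (inFibre (just j) h) ≡⟨ fibre-sum (just j) h ⟩
    (if ⌊ AB ≟V just j ⌋ then h B else 0) + ((if ⌊ nothing ≟V just j ⌋ then h nothing else 0) +
      sumFin (λ i → if ⌊ just i ≟V just j ⌋ then h (W i) else 0))
      ≡⟨ cong₂ _+_ (cong (λ z → if z then h B else 0) (⌊⌋-false (AB ≟V just j) (λ e → j≢ab (sym (MP.just-injective e)))))
           (cong₂ _+_ (cong (λ z → if z then h nothing else 0) (⌊⌋-false (nothing ≟V just j) (λ ())))
              (sumFin-indicator-just j (λ i → h (W i)))) ⟩
    h (W j) ∎

  Matrix : Set
  Matrix = Vtx (suc m) → Vtx (suc m) → ℕ

  masked : Matrix → Vtx m → Vtx m → Matrix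
  masked F u w x y = if ⌊ π x ≟V u ⌋ ∧ ⌊ π y ≟V w ⌋ then F x y else 0

  collapse : Matrix → Vtx m → Vtx m → ℕ
  collapse F u w = sumV (λ x → sumV (masked F u w x))

  column : Matrix → Vtx m → ℕ
  column F w = sumV (λ x → sumV (inFibre w (F x)))

  collapse-nested : ∀ F u w → collapse F u w ≡ sumV (λ x → inFibre u (λ x′ → sumV (inFibre w (F x′))) x)
  collapse-nested F u w = sumV-cong (λ x →
    trans (sumV-cong (λ y → if-∧ ⌊ π x ≟V u ⌋ ⌊ π y ≟V w ⌋ (F x y)))
          (sym (if-then-sumV ⌊ π x ≟V u ⌋ (inFibre w (F x)))))

  sumV-collapse : ∀ F w → sumV (λ u → collapse F u w) ≡ column F w
  sumV-collapse F w = begin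
    sumV (λ u → collapse F u w)                  ≡⟨ sumV-cong (λ u → collapse-nested F u w) ⟩
    sumV (λ u → sumV (λ x → inFibre u G x))      ≡⟨ sumV-comm (λ u x → inFibre u G x) ⟩
    sumV (λ x → sumV (λ u → inFibre u G x))      ≡⟨ sumV-cong (λ x → sumV-indicator (π x) (λ _ → G x)) ⟩
    column F w                                   ∎
    where
    G : Vtx (suc m) → ℕ
    G x = sumV (inFibre w (F x))

  collapse-transpose : ∀ F u w → collapse F w u ≡ collapse (λ x y → F y x) u w
  collapse-transpose F u w = trans (sumV-comm (masked F w u))
    (sumV-cong (λ y → sumV-cong (λ x → cong (λ z → if z then F x y else 0) (∧-comm ⌊ π x ≟V w ⌋ ⌊ π y ≟V u ⌋))))

  collapse-+ : ∀ F G u w → collapse F u w + collapse G u w ≡ collapse (λ x y → F x y + G x y) u w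
  collapse-+ F G u w = trans (sym (sumV-+ (λ x → sumV (masked F u w x)) (λ x → sumV (masked G u w x))))
    (sumV-cong (λ x → trans (sym (sumV-+ (masked F u w x) (masked G u w x)))
                            (sumV-cong (λ y → if-+ (⌊ π x ≟V u ⌋ ∧ ⌊ π y ≟V w ⌋) (F x y) (G x y)))))

  collapse-cong : ∀ {F G : Matrix} → (∀ x y → F x y ≡ G x y) → ∀ u w → collapse F u w ≡ collapse G u w
  collapse-cong e u w =
    sumV-cong (λ x → sumV-cong (λ y → cong (λ z → if ⌊ π x ≟V u ⌋ ∧ ⌊ π y ≟V w ⌋ then z else 0) (e x y)))

  column-other : ∀ F j → j ≢ ab → column F (just j) ≡ sumV (λ x → F x (W j))
  column-other F j j≢ab = sumV-cong (λ x → fibre-sum-other j j≢ab (F x))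

  column-ab : ∀ F → column F AB ≡ sumV (λ x → F x A) + sumV (λ x → F x B)
  column-ab F = trans (sumV-cong (λ x → fibre-sum-ab (F x))) (sumV-+ (λ x → F x A) (λ x → F x B))

  collapse-diag-other : ∀ F j → j ≢ ab → collapse F (just j) (just j) ≡ F (W j) (W j)
  collapse-diag-other F j j≢ab = trans (collapse-nested F (just j) (just j))
    (trans (sumV-cong (λ x → cong (λ z → if ⌊ π x ≟V just j ⌋ then z else 0) (fibre-sum-other j j≢ab (F x))))
           (fibre-sum-other j j≢ab (λ x → F x (W j))))

  collapse-diag-ab : ∀ F → collapse F AB AB ≡ (F A A + F A B) + (F B A + F B B)
  collapse-diag-ab F = trans (collapse-nested F AB AB)
    (trans (sumV-cong (λ x → cong (λ z → if ⌊ π x ≟V AB ⌋ then z else 0) (fibre-sum-ab (F x))))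
           (fibre-sum-ab (λ x → F x A + F x B)))

  off-diagonal : (Vtx m → Vtx m → ℕ) → Vtx m → Vtx m → ℕ
  off-diagonal E u w = if ⌊ u ≟V w ⌋ then 0 else E u w

  contractWith : Matrix → (Vtx m → Vtx m → ℕ) → Vtx m → Vtx m → ℕ
  contractWith F E u w = off-diagonal (λ u′ w′ → collapse F u′ w′ + E u′ w′) u w

  sumV-contractWith : ∀ F E w →
    sumV (λ u → contractWith F E u w) + collapse F w w ≡ column F w + sumV (λ u → off-diagonal E u w)
  sumV-contractWith F E w = begin
    sumV (λ u → contractWith F E u w) + collapse F w w
      ≡⟨ cong (_+ collapse F w w) (trans (sumV-cong (λ u → if-else-+ ⌊ u ≟V w ⌋ (collapse F u w) (E u w)))
                                         (sumV-+ X Y)) ⟩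
    sumV X + sumV Y + collapse F w w      ≡⟨ +-assoc (sumV X) _ _ ⟩
    sumV X + (sumV Y + collapse F w w)    ≡⟨ cong (sumV X +_) (+-comm (sumV Y) _) ⟩
    sumV X + (collapse F w w + sumV Y)    ≡⟨ +-assoc (sumV X) _ _ ⟨
    sumV X + collapse F w w + sumV Y      ≡⟨ cong (_+ sumV Y) (sumV-except w (λ u → collapse F u w)) ⟩
    sumV (λ u → collapse F u w) + sumV Y  ≡⟨ cong (_+ sumV Y) (sumV-collapse F w) ⟩
    column F w + sumV Y                   ∎
    where
    X = λ u → off-diagonal (collapse F) u w
    Y = λ u → off-diagonal E u w

  extra : ℕ
  extra = M A B ∸ 1

  sinkEdges : Vtx m → Vtx m → ℕ
  sinkEdges u w = if isPair AB nothing u w then extra else 0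

  sinkArcs : Vtx m → Vtx m → ℕ
  sinkArcs u w = if ⌊ u ≟V nothing ⌋ ∧ ⌊ w ≟V AB ⌋ then extra else 0

  M/e : Mult m
  M/e = contractM

  sinkEdges-sym : ∀ u w → sinkEdges u w ≡ sinkEdges w u
  sinkEdges-sym nothing nothing = refl
  sinkEdges-sym nothing (just j) = sym (sinkEdges-sym (just j) nothing)
  sinkEdges-sym (just i) nothing = cong (λ z → if z then extra else 0) (trans (∨-comm _ false) (∧-comm ⌊ just i ≟V AB ⌋ true))
  sinkEdges-sym (just i) (just j) = cong (λ z → if z then extra else 0)
     (trans (cong (_∨ false) (∧-zeroʳ ⌊ just i ≟V AB ⌋)) (sym (cong (_∨ false) (∧-zeroʳ ⌊ just j ≟V AB ⌋))))

  sinkArcs-split : ∀ u w → sinkArcs u w + sinkArcs w u ≡ sinkEdges u w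
  sinkArcs-split nothing nothing = refl
  sinkArcs-split nothing (just j) = +-identityʳ _
  sinkArcs-split (just i) nothing = cong (λ z → if z then extra else 0) (sym (trans (∨-identityʳ _) (∧-identityʳ _)))
  sinkArcs-split (just i) (just j) = cong (λ z → if z then extra else 0) (sym (cong (_∨ false) (∧-zeroʳ ⌊ just i ≟V AB ⌋)))

  contract-sym : Symmetric M → Symmetric M/e
  contract-sym sy u w = begin
    contractWith M sinkEdges u w ≡⟨ cong (λ z → if z then 0 else (collapse M u w + sinkEdges u w)) (⌊⌋-sym (u ≟V w) (w ≟V u)) ⟩
    (if ⌊ w ≟V u ⌋ then 0 else (collapse M u w + sinkEdges u w))
      ≡⟨ cong (λ z → if ⌊ w ≟V u ⌋ then 0 else z)
           (cong₂ _+_ (trans (collapse-cong (λ x y → sy x y) u w) (sym (collapse-transpose M u w))) (sinkEdges-sym u w)) ⟩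
    contractWith M sinkEdges w u ∎

  contract-loopFree : LoopFree M/e
  contract-loopFree u rewrite ⌊⌋-true (u ≟V u) refl = refl

  module ContractOrientation (O : Orientation M) where
    open Orientation O
    o/e : Vtx m → Vtx m → ℕ
    o/e = contractWith o sinkArcs

    split/e : ∀ u w → o/e u w + o/e w u ≡ M/e u w
    split/e u w = by-cases (u ≟V w)
     where
     by-cases : Dec (u ≡ w) → o/e u w + o/e w u ≡ M/e u w
     by-cases (yes refl) rewrite ⌊⌋-true (u ≟V u) refl = refl
     by-cases (no u≢w) rewrite ⌊⌋-false (u ≟V w) u≢w | ⌊⌋-false (w ≟V u) (λ e → u≢w (sym e)) = begin
      (collapse o u w + sinkArcs u w) + (collapse o w u + sinkArcs w u) ≡⟨ interchange (collapse o u w) _ _ _ ⟩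
      (collapse o u w + collapse o w u) + (sinkArcs u w + sinkArcs w u)
        ≡⟨ cong₂ _+_ (trans (cong (collapse o u w +_) (collapse-transpose o u w))
                       (trans (collapse-+ o (λ x y → o y x) u w) (collapse-cong (λ x y → split x y) u w)))
                     (sinkArcs-split u w) ⟩
      collapse M u w + sinkEdges u w ∎

    O/e : Orientation M/e
    O/e = record { o = o/e ; split = split/e }

    module _ (lf : LoopFree M) where
      indeg-O/e-other : ∀ j → j ≢ ab → indeg O/e (just j) ≡ indeg O (W j)
      indeg-O/e-other j j≢ab = +-cancelʳ-≡ 0 _ _ (begin
        indeg O/e (just j) + 0 ≡⟨ cong (indeg O/e (just j) +_) (sym (trans (collapse-diag-other o j j≢ab) (o-loop≡0 O lf (W j)))) ⟩
        indeg O/e (just j) + collapse o (just j) (just j) ≡⟨ sumV-contractWith o sinkArcs (just j) ⟩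
        column o (just j) + sumV (λ u → off-diagonal sinkArcs u (just j))
          ≡⟨ cong₂ _+_ (column-other o j j≢ab) (sumV-zero _ off-j) ⟩
        indeg O (W j) + 0 ∎)
        where
        ⌊j≟AB⌋ : ⌊ just j ≟V AB ⌋ ≡ false
        ⌊j≟AB⌋ = ⌊⌋-false (just j ≟V AB) (λ e → j≢ab (MP.just-injective e))
        off-j : ∀ u → off-diagonal sinkArcs u (just j) ≡ 0
        off-j u rewrite ⌊j≟AB⌋ | ∧-zeroʳ ⌊ u ≟V nothing ⌋ = if-0-0 ⌊ u ≟V just j ⌋

      indeg-O/e-ab : 1 ≤ M A B → indeg O/e AB + 1 ≡ indeg O A + indeg O B
      indeg-O/e-ab ab = +-cancelʳ-≡ extra _ _ (begin
        indeg O/e AB + 1 + extra ≡⟨ +-assoc (indeg O/e AB) 1 extra ⟩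
        indeg O/e AB + (1 + extra) ≡⟨ cong (indeg O/e AB +_) (trans (+-comm 1 extra) (m∸n+n≡m ab)) ⟩
        indeg O/e AB + M A B ≡⟨ cong (indeg O/e AB +_) (sym collapse-AB) ⟩
        indeg O/e AB + collapse o AB AB ≡⟨ sumV-contractWith o sinkArcs AB ⟩
        column o AB + sumV (λ u → off-diagonal sinkArcs u AB) ≡⟨ cong₂ _+_ (column-ab o) sinkArcs-into-AB ⟩
        indeg O A + indeg O B + extra ∎)
        where
        collapse-AB : collapse o AB AB ≡ M A B
        collapse-AB = begin
          collapse o AB AB ≡⟨ collapse-diag-ab o ⟩
          (o A A + o A B) + (o B A + o B B) ≡⟨ cong₂ (λ x y → (x + o A B) + (o B A + y)) (o-loop≡0 O lf A) (o-loop≡0 O lf B) ⟩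
          (0 + o A B) + (o B A + 0) ≡⟨ cong ((o A B) +_) (+-identityʳ (o B A)) ⟩
          o A B + o B A ≡⟨ split A B ⟩
          M A B ∎
        sinkArcs-into-AB : sumV (λ u → off-diagonal sinkArcs u AB) ≡ extra
        sinkArcs-into-AB rewrite ⌊⌋-true (AB ≟V AB) refl =
          trans (cong (extra +_) (sumFin-zero _ (λ i → if-0-0 ⌊ just i ≟V AB ⌋))) (+-identityʳ extra)

  deg-contract-other : Symmetric M → LoopFree M → ∀ j → j ≢ ab → deg M/e (just j) ≡ deg M (W j)
  deg-contract-other sy lf j j≢ab = +-cancelʳ-≡ 0 _ _ (begin
    deg M/e (just j) + 0 ≡⟨ cong₂ _+_ (sumV-cong (λ u → contract-sym sy (just j) u)) (sym (trans (collapse-diag-other M j j≢ab) (lf (W j)))) ⟩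
    sumV (λ u → M/e u (just j)) + collapse M (just j) (just j) ≡⟨ sumV-contractWith M sinkEdges (just j) ⟩
    column M (just j) + sumV (λ u → off-diagonal sinkEdges u (just j))
      ≡⟨ cong₂ _+_ (trans (column-other M j j≢ab) (sumV-cong (λ x → sy x (W j)))) (sumV-zero _ off-j) ⟩
    deg M (W j) + 0 ∎)
    where
    ⌊j≟AB⌋ : ⌊ just j ≟V AB ⌋ ≡ false
    ⌊j≟AB⌋ = ⌊⌋-false (just j ≟V AB) (λ e → j≢ab (MP.just-injective e))
    off-j : ∀ u → off-diagonal sinkEdges u (just j) ≡ 0
    off-j u rewrite ⌊j≟AB⌋ | ∧-zeroʳ ⌊ u ≟V AB ⌋ | ∧-zeroʳ ⌊ u ≟V nothing ⌋ = if-0-0 ⌊ u ≟V just j ⌋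

  entry≤collapse : ∀ (F : Matrix) y z → F y z ≤ collapse F (π y) (π z)
  entry≤collapse F y z =
    ≤-trans (≤-reflexive (sym at-yz)) (≤-trans (term≤sumV (row y) z) (term≤sumV (λ x → sumV (row x)) y))
    where
    row : Vtx (suc m) → Vtx (suc m) → ℕ
    row x y′ = if ⌊ π x ≟V π y ⌋ ∧ ⌊ π y′ ≟V π z ⌋ then F x y′ else 0
    at-yz : row y z ≡ F y z
    at-yz rewrite ⌊⌋-true (π y ≟V π y) refl | ⌊⌋-true (π z ≟V π z) refl = refl

  edge-quotient : ∀ y z → 0 < M y z → (π y ≡ π z) ⊎ (0 < M/e (π y) (π z))
  edge-quotient y z p = by-cases (π y ≟V π z)
    where
    by-cases : Dec (π y ≡ π z) → (π y ≡ π z) ⊎ (0 < M/e (π y) (π z))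
    by-cases (yes e) = inj₁ e
    by-cases (no πy≢πz) = inj₂ (≤-trans p (≤-trans (entry≤collapse M y z) (≤-trans (m≤m+n _ _) (≤-reflexive (sym M/e≡)))))
      where
      M/e≡ : M/e (π y) (π z) ≡ collapse M (π y) (π z) + sinkEdges (π y) (π z)
      M/e≡ = cong (λ q → if q then 0 else (collapse M (π y) (π z) + sinkEdges (π y) (π z))) (⌊⌋-false (π y ≟V π z) πy≢πz)

  contract-connected : Connected M → Connected M/e
  contract-connected = Connected-map π refl edge-quotient (λ j → W j , π-W j)


-- Case (B) holds for every stable η with a compatible orientation: the k edges between a and b
-- contribute k to in(a) + in(b) and are replaced by the k − 1 edges s → a.b.
module CaseB {m} (M : Mult (suc m)) (sy : Symmetric M) (lf : LoopFree M) (cn : Connected M)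
  (a b : Fin (suc m)) (a≢b : a ≢ b) (a–b : 1 ≤ M (just a) (just b))
  (η : Config (suc m)) (st : Stable M η) (O : Orientation M) (cp : Compatible M η O) where
  open ContractionFacts M a b a≢b
  open ContractOrientation O
  open Contraction M a b a≢b using (ab; b≢a)

  L : ℕ
  L = lvl M η a + lvl M η b

  d : ℕ
  d = deg M/e AB

  ζ : Config m
  ζ j = if ⌊ j F.≟ ab ⌋ then d ∸ L else η (punchIn b j)

  ζ-ab : ζ ab ≡ d ∸ L
  ζ-ab rewrite ⌊⌋-true (ab F.≟ ab) refl = refl

  ζ-other : ∀ j → j ≢ ab → ζ j ≡ η (punchIn b j)
  ζ-other j j≢ab rewrite ⌊⌋-false (j F.≟ ab) j≢ab = refl

  L<indeg : suc L ≤ indeg O/e AB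
  L<indeg = +-cancelʳ-≤ 1 _ _ (begin
    suc L + 1                          ≡⟨ +-comm (suc L) 1 ⟩
    suc (suc L)                        ≡⟨ cong suc (+-suc (lvl M η a) (lvl M η b)) ⟨
    suc (lvl M η a) + suc (lvl M η b)  ≤⟨ +-mono-≤ (cp a) (cp b) ⟩
    indeg O A + indeg O B              ≡⟨ indeg-O/e-ab lf a–b ⟨
    indeg O/e AB + 1                   ∎)
    where open ≤-Reasoning

  L≤d : L ≤ d
  L≤d = ≤-trans (n≤1+n L) (≤-trans L<indeg
          (subst (indeg O/e AB ≤_) (outdeg+indeg≡deg O/e AB) (m≤n+m (indeg O/e AB) (outdeg O/e AB))))

  ζ-stable : Stable M/e ζ
  ζ-stable j = by-cases (j F.≟ ab)
    where
    by-cases : Dec (j ≡ ab) → ζ j ≤ deg M/e (just j)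
    by-cases (yes refl) = subst (_≤ d) (sym ζ-ab) (m∸n≤m d L)
    by-cases (no j≢ab) = subst₂ _≤_ (sym (ζ-other j j≢ab)) (sym (deg-contract-other sy lf j j≢ab)) (st (punchIn b j))

  ζ-compatible : Compatible M/e ζ O/e
  ζ-compatible j = by-cases (j F.≟ ab)
    where
    by-cases : Dec (j ≡ ab) → suc (lvl M/e ζ j) ≤ indeg O/e (just j)
    by-cases (yes refl) = subst (λ z → suc z ≤ indeg O/e AB) (sym (trans (cong (d ∸_) ζ-ab) (m∸[m∸n]≡n L≤d))) L<indeg
    by-cases (no j≢ab) = subst₂ (λ x y → suc x ≤ y)
      (sym (cong₂ _∸_ (deg-contract-other sy lf j j≢ab) (ζ-other j j≢ab))) (sym (indeg-O/e-other lf j j≢ab)) (cp (punchIn b j))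

  result : Σ (Config m) λ ζ → Sto (Contraction.contractM M a b a≢b) ζ ×
             (∀ (x : Fin (suc m)) (x≢a : x ≢ a) (x≢b : x ≢ b) →
                ζ (punchOut {i = b} {j = x} (λ e → x≢b (sym e))) ≡ η x) ×
             ζ ab + (lvl M η a + lvl M η b) ≡ deg M/e AB
  result with compatible⇒Sto m M/e (contract-sym sy) contract-loopFree (contract-connected cn) ζ ζ-stable O/e ζ-compatible
  ... | ζ′ , ζ′≗ζ , s′ = ζ′ , s′ , unchanged , trans (cong (_+ L) (trans (ζ′≗ζ ab) ζ-ab)) (m∸n+n≡m L≤d)
    where
    unchanged : ∀ (x : Fin (suc m)) (x≢a : x ≢ a) (x≢b : x ≢ b) →
                  ζ′ (punchOut {i = b} {j = x} (λ e → x≢b (sym e))) ≡ η x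
    unchanged x x≢a x≢b = trans (ζ′≗ζ j) (trans (ζ-other j j≢ab) (cong η (FP.punchIn-punchOut _)))
      where
      j = punchOut {i = b} {j = x} (λ e → x≢b (sym e))
      j≢ab : j ≢ ab
      j≢ab q = x≢a (FP.punchOut-injective _ b≢a q)

caseA : ∀ {n} (M : Mult n) (a b : Fin n) (a≢b : a ≢ b) → Symmetric M → LoopFree M →
  1 ≤ M (just a) (just b) → Connected (delete M a b) → (η : Config n) → StoA M a b η →
  Σ (Config n) λ ζ → Sto (delete M a b) ζ × ζ a + 1 ≡ η a × (∀ v → v ≢ a → ζ v ≡ η v)
caseA M a b a≢b sy lf a–b cn∖e η (s , l-b>0 , O , cp , a→b) =
  CaseA.result M a b a≢b sy lf a–b cn∖e η (Sto⇒Stable s) l-b>0 O cp a→b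

caseB : ∀ {m} (M : Mult (suc m)) → Symmetric M → LoopFree M → Connected M →
  (a b : Fin (suc m)) (a≢b : a ≢ b) → 1 ≤ M (just a) (just b) → (η : Config (suc m)) → Sto M η →
  Σ (Config m) λ ζ → Sto (Contraction.contractM M a b a≢b) ζ ×
    (∀ (x : Fin (suc m)) (x≢a : x ≢ a) (x≢b : x ≢ b) → ζ (punchOut {i = b} {j = x} (λ e → x≢b (sym e))) ≡ η x) ×
    ζ (Contraction.ab M a b a≢b) + (lvl M η a + lvl M η b)
      ≡ deg (Contraction.contractM M a b a≢b) (just (Contraction.ab M a b a≢b))
caseB {m} M sy lf cn a b a≢b a–b η s with positive-indeg-orientation (suc m) M sy lf cn
... | O₀ , in≥1 with Sto⇒compatible lf O₀ in≥1 s
... | O , cp = CaseB.result M sy lf cn a b a≢b a–b η (Sto⇒Stable s) O cp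

-- p never enters: Sto only records transitions of positive probability.  The conclusion of case (B)
-- holds on all of Sto G.
lemma4p4 : (m : ℕ) (M : Mult (suc m)) → Symmetric M → LoopFree M → Connected M →
    (p : ℚ) → 0ℚ <ℚ p → p <ℚ 1ℚ →
    (a b : Fin (suc m)) (a≢b : a ≢ b) → 1 ≤ M (just a) (just b) →
    Connected (delete M a b) →
    (η : Config (suc m)) → Sto M η →
      (StoA M a b η →
        Σ (Config (suc m)) λ ζ → Sto (delete M a b) ζ ×
          ζ a + 1 ≡ η a × (∀ v → v ≢ a → ζ v ≡ η v))
      × (¬ StoA M a b η →
        Σ (Config m) λ ζ → Sto (Contraction.contractM M a b a≢b) ζ ×
          (∀ (x : Fin (suc m)) (x≢a : x ≢ a) (x≢b : x ≢ b) →
             ζ (punchOut {i = b} {j = x} (λ e → x≢b (sym e))) ≡ η x) ×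
          ζ (Contraction.ab M a b a≢b) + (lvl M η a + lvl M η b)
            ≡ deg (Contraction.contractM M a b a≢b) (just (Contraction.ab M a b a≢b)))
lemma4p4 m M sy lf cn _ _ _ a b a≢b a–b cn∖e η s =
  caseA M a b a≢b sy lf a–b cn∖e η , λ _ → caseB M sy lf cn a b a≢b a–b η s
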